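{- Let $q$ be a power of an odd prime, let $n\ge 2$ be an even integer, and let $a,c\in\mathbb{F}_q$. Let $f:\mathbb{F}_{q^2}\to\mathbb{F}_{q^2}$ be given by $f(X)=(cX^q+aX)(X^q-X)^{n-1}$. Fix $\beta\in\mathbb{F}_{q^2}\setminus\mathbb{F}_q$ with $\beta^2\in\mathbb{F}_q$, put $\delta_1=(a-c)(-2)^{n-1}\beta^n$ and $\delta_2=(a+c)(-2)^{n-1}\beta^{n-2}$, and assume $\delta_1\delta_2\neq0$. Write $\mathfrak{g}(m)=\gcd(m,q-1)$. Write $q-1=sr$, where $r$ is the largest divisor of $q-1$ with $\gcd(r,n)=1$, and let $e$ be the largest nonnegative integer such that $\mathfrak{g}(n^e)<s$. Then every nonzero periodic element of the functional graph of $f$ on $\mathbb{F}_{q^2}$ is the root of a tree of height $e+1$.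
   Context: The functional graph of $f$ is the directed graph on $\mathbb{F}_{q^2}$ with edges $x\to f(x)$. An element $x$ is periodic if $f^{(k)}(x)=x$ for some $k\ge1$, where $f^{(k)}$ denotes the $k$-fold iterate. The tree hanging from (rooted at) a periodic element $z$ consists of $z$ together with all non-periodic elements $x$ whose forward orbit $x,f(x),f^{(2)}(x),\dots$ first reaches a periodic element at $z$, with the edges $x\to f(x)$ among them; the level of such an $x$ is the number of iterations needed to reach $z$, and the height of the tree is the maximal level of its vertices. -}

module Defs where

open import Level using (0ℓ)
open import Data.Nat using (ℕ; zero; suc; _<_; _≤_)
open import Data.Nat.Coprimality using (Coprime)
open import Data.Nat.Divisibility using (_∣_)
open import Data.Fin using (Fin)
open import Data.Product using (Σ; ∃; _×_)
open import Function.Bundles using (_↔_)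
open import Relation.Binary.PropositionalEquality using (_≡_; _≢_)
open import Relation.Nullary using (¬_)
open import Algebra.Structures using (IsCommutativeRing)

record FiniteField : Set₁ where
  infixl 6 _+_
  infixl 7 _*_
  infix 8 -_
  field
    Carrier : Set
    _+_ _*_ : Carrier → Carrier → Carrier
    -_      : Carrier → Carrier
    0# 1#   : Carrier
    isCommutativeRing : IsCommutativeRing _≡_ _+_ _*_ -_ 0# 1#
    0≢1     : 0# ≢ 1#
    inverse : ∀ x → x ≢ 0# → Σ Carrier (λ y → x * y ≡ 1#)
    size    : ℕ
    enum    : Carrier ↔ Fin size

  infixl 6 _-_
  _-_ : Carrier → Carrier → Carrier
  x - y = x + (- y)

  infixr 9 _^_
  _^_ : Carrier → ℕ → Carrier
  x ^ zero  = 1#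
  x ^ suc m = x * (x ^ m)

iter : {A : Set} → (A → A) → ℕ → A → A
iter f zero    x = x
iter f (suc k) x = f (iter f k x)

Periodic : {A : Set} → (A → A) → A → Set
Periodic f x = Σ ℕ (λ k → iter f (suc k) x ≡ x)

-- x lies in the tree hanging from z at level l: the first periodic element
-- of the forward orbit of x is z, reached after exactly l iterations.
AtLevel : {A : Set} → (A → A) → (z x : A) → ℕ → Set
AtLevel f z x l = (iter f l x ≡ z) × (∀ i → i < l → ¬ Periodic f (iter f i x))

TreeHeight : {A : Set} → (A → A) → A → ℕ → Set
TreeHeight {A} f z h = Σ A (λ x → AtLevel f z x h) × (∀ x l → AtLevel f z x l → l ≤ h)

-- 𝔤(m) = gcd(m, q-1) is used via Data.Nat.GCD.gcd directly.

LargestCoprimeDivisor : (N n r : ℕ) → Set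
LargestCoprimeDivisor N n r =
  (r ∣ N) × Coprime r n × (∀ d → d ∣ N → Coprime d n → d ≤ r)

-- Write x ∈ 𝔽_{q²} as α + γβ with α, γ ∈ 𝔽_q. Since x^q = α − γβ, in these coordinates f becomes
-- T (α , γ) = (δ₁ γⁿ , δ₂ α γⁿ⁻¹), and ψ (α , γ) = α γⁿ semiconjugates T to h P = κ Pⁿ on 𝔽_q, κ = δ₁ δ₂ⁿ.
-- Points with a vanishing coordinate reach 0 after two steps, so nonzero periodic points have invertible
-- coordinates. On such points T² preserves α/γ, hence a point is T-periodic as soon as its ψ-value is
-- h-periodic. As hᵗ P = κ^(1+n+⋯+nᵗ⁻¹) P^(nᵗ) and P^(q−1) = 1, while s ∣ n^(e+1) and r is coprime to n,
-- every h-orbit in 𝔽_q^× is periodic after e+1 steps: trees have height at most e+1. Conversely, if u is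
-- periodic and v is a periodic point with T^(e+1) v = u, then η v is at level exactly e+1 in the tree of u
-- for any η ∈ 𝔽_q^× with η^(n^(e+1)) = 1 ≠ η^(n^e); such an η exists because gcd(n^e, q−1) < s.

module Submission where

open import Defs
open import Data.Nat using (ℕ; suc; _∸_; _<_; _≤_) renaming (_^_ to _^ℕ_; _*_ to _*ℕ_)
open import Data.Nat.Divisibility using (_∣_)
open import Data.Nat.GCD using (gcd)
open import Data.Nat.Primality using (Prime)
open import Relation.Binary.PropositionalEquality using (_≡_; _≢_)

open import Level using (0ℓ)
open import Algebra.Bundles using (CommutativeRing; CommutativeMonoid)
open import Data.Empty using (⊥-elim)
open import Data.Fin as Fin using (Fin; toℕ; inject₁; fromℕ; inject≤)
import Data.Fin.Properties as Fin
import Data.Integer as ℤ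
open import Data.Nat as ℕ using (zero; z≤n; s≤s)
import Data.Nat.Properties as ℕ
open import Data.Nat.Combinatorics using (_C_; nCn≡1)
open import Data.Nat.Coprimality using (Coprime)
open import Data.Nat.Divisibility using (divides; *-pres-∣; ∣m+n∣m⇒∣n; ∣-refl)
open import Data.Nat.GCD using (gcd-GCD; module Bézout; gcd[m,n]≢0)
open import Data.Nat.Primality using (prime⇒nonZero)
open import Data.Nat.Tactic.RingSolver using (solve-∀)
open import Data.Product using (Σ; _,_; proj₁; proj₂; _×_)
open import Data.Sum using (_⊎_; inj₁; inj₂)
open import Data.Vec using (Vec; []; _∷_)
open import Function using (id; _∘_; _↔_; Inverse; mk↔ₛ′)
open import Function.Construct.Composition using (_↔-∘_)
open import Function.Construct.Symmetry using (↔-sym)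
open import Function.Definitions using (Injective)
open import Function.Properties.Inverse using (↔⇒↣)
open import Relation.Binary.Definitions using (DecidableEquality)
open import Relation.Binary.PropositionalEquality using (refl; sym; trans; cong; cong₂; subst; subst₂; module ≡-Reasoning)
open import Relation.Nullary using (¬_; yes; no; contradiction)

iter-fix : ∀ {A : Set} {g : A → A} {x} → g x ≡ x → ∀ t → iter g t x ≡ x
iter-fix         gx≡x zero    = refl
iter-fix {g = g} gx≡x (suc t) = trans (cong g (iter-fix gx≡x t)) gx≡x

module _ {A : Set} (g : A → A) where

  iter-+ : ∀ a b x → iter g (a ℕ.+ b) x ≡ iter g a (iter g b x)
  iter-+ zero    b x = refl
  iter-+ (suc a) b x = cong g (iter-+ a b x)

  iter-* : ∀ a b x → iter g (a ℕ.* b) x ≡ iter (iter g b) a x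
  iter-* zero    b x = refl
  iter-* (suc a) b x = trans (iter-+ b (a ℕ.* b) x) (cong (iter g b) (iter-* a b x))

  iter-period : ∀ {x} k → iter g k x ≡ x → ∀ t → iter g (t ℕ.* k) x ≡ x
  iter-period k gᵏx≡x t = trans (iter-* t k _) (iter-fix gᵏx≡x t)

  Periodic-iter : ∀ {x} j → Periodic g x → Periodic g (iter g j x)
  Periodic-iter {x} j (k , gᵏ⁺¹x≡x) = k , (begin
    iter g (suc k) (iter g j x)  ≡⟨ iter-+ (suc k) j x ⟨
    iter g (suc k ℕ.+ j) x       ≡⟨ cong (λ i → iter g i x) (ℕ.+-comm (suc k) j) ⟩
    iter g (j ℕ.+ suc k) x       ≡⟨ iter-+ j (suc k) x ⟩
    iter g j (iter g (suc k) x)  ≡⟨ cong (iter g j) gᵏ⁺¹x≡x ⟩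
    iter g j x                   ∎)
    where open ≡-Reasoning

module _ {A B : Set} (g : A → A) (h : B → B) (π : A → B) (semiconj : ∀ x → π (g x) ≡ h (π x)) where

  iter-semiconj : ∀ j x → π (iter g j x) ≡ iter h j (π x)
  iter-semiconj zero    x = refl
  iter-semiconj (suc j) x = trans (semiconj (iter g j x)) (cong h (iter-semiconj j x))

  Periodic-semiconj : ∀ {x} → Periodic g x → Periodic h (π x)
  Periodic-semiconj {x} (k , gᵏ⁺¹x≡x) = k , trans (sym (iter-semiconj (suc k) x)) (cong π gᵏ⁺¹x≡x)

module Arithmetic where
  open import Data.Nat as ℕ using (ℕ; zero; suc; _+_; _*_; _^_; _∸_; _<_; _≤_; z≤n; s≤s; _!; NonZero; nonTrivial⇒n>1)
  import Data.Nat.Properties as ℕ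
  open import Data.Nat.Combinatorics using (_C_; nCk≡n!/k![n-k]!; k![n∸k]!∣n!)
  open import Data.Nat.Coprimality using (Coprime; coprime-divisor)
  import Data.Nat.Coprimality as Coprime
  open import Data.Nat.DivMod using (_/_; _%_; m≡m%n+[m/n]*n; m%n<n; m/n*n≡m)
  open import Data.Nat.Divisibility using (_∣_; divides; ∣-trans; ∣1⇒≡1; ∣⇒≤; m∣m*n)
  open import Data.Nat.GCD using (gcd; gcd[m,n]∣m; gcd[m,n]∣n)
  open import Data.Nat.Primality using (Prime; euclidsLemma; prime⇒nonTrivial; prime⇒irreducible)
  open import Data.Nat.Tactic.RingSolver using (solve-∀)
  open import Data.Fin using (toℕ; fromℕ<)
  import Data.Fin.Properties as Fin
  open import Data.Product using (Σ; ∃; _,_)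
  open import Data.Sum using (inj₁; inj₂)
  open import Relation.Binary.PropositionalEquality using (_≡_; _≢_; refl; sym; trans; cong; cong₂; subst; module ≡-Reasoning)
  open import Relation.Nullary using (¬_; contradiction)

  repunit : ℕ → ℕ → ℕ
  repunit n zero    = 0
  repunit n (suc t) = suc (n * repunit n t)

  repunit-+ : ∀ n a b → repunit n (a + b) ≡ repunit n a + n ^ a * repunit n b
  repunit-+ n zero    b = sym (ℕ.+-identityʳ (repunit n b))
  repunit-+ n (suc a) b = cong suc (begin
    n * repunit n (a + b)                        ≡⟨ cong (n *_) (repunit-+ n a b) ⟩
    n * (repunit n a + n ^ a * repunit n b)      ≡⟨ ℕ.*-distribˡ-+ n (repunit n a) _ ⟩
    n * repunit n a + n * (n ^ a * repunit n b)  ≡⟨ cong (n * repunit n a +_) (ℕ.*-assoc n (n ^ a) _) ⟨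
    n * repunit n a + n * n ^ a * repunit n b    ∎)
    where open ≡-Reasoning

  [1+m]^t≡1+repunit*m : ∀ m t → suc m ^ t ≡ suc (repunit (suc m) t * m)
  [1+m]^t≡1+repunit*m m zero    = refl
  [1+m]^t≡1+repunit*m m (suc t) = trans (cong (suc m *_) ([1+m]^t≡1+repunit*m m t)) (step m (repunit (suc m) t))
    where
    step : ∀ m R → suc m * suc (R * m) ≡ suc (suc (suc m * R) * m)
    step = solve-∀

  %-≡⇒∣ : ∀ r .{{_ : NonZero r}} x y → x % r ≡ (x + y) % r → r ∣ y
  %-≡⇒∣ r x y x%r≡[x+y]%r = divides ((x + y) / r ∸ x / r) (begin
    y                                                    ≡⟨ ℕ.m+n∸m≡n x y ⟨
    (x + y) ∸ x                                          ≡⟨ cong₂ _∸_ (m≡m%n+[m/n]*n (x + y) r) (m≡m%n+[m/n]*n x r) ⟩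
    ((x + y) % r + (x + y) / r * r) ∸ (x % r + x / r * r) ≡⟨ cong (λ t → ((x + y) % r + (x + y) / r * r) ∸ (t + x / r * r)) x%r≡[x+y]%r ⟩
    ((x + y) % r + (x + y) / r * r) ∸ ((x + y) % r + x / r * r) ≡⟨ ℕ.[m+n]∸[m+o]≡n∸o ((x + y) % r) _ _ ⟩
    (x + y) / r * r ∸ x / r * r                          ≡⟨ ℕ.*-distribʳ-∸ r ((x + y) / r) (x / r) ⟨
    ((x + y) / r ∸ x / r) * r                            ∎)
    where open ≡-Reasoning

  module _ {r n : ℕ} (r⊥n : Coprime r n) where

    coprime-*ʳ : ∀ {a b} → Coprime r a → Coprime r b → Coprime r (a * b)
    coprime-*ʳ r⊥a r⊥b (d∣r , d∣ab) =
      r⊥b (d∣r , coprime-divisor (λ (e∣d , e∣a) → r⊥a (∣-trans e∣d d∣r , e∣a)) d∣ab)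

    coprime-^ : ∀ E → Coprime r (n ^ E)
    coprime-^ zero    (d∣r , d∣1) = ∣1⇒≡1 d∣1
    coprime-^ (suc E) = coprime-*ʳ r⊥n (coprime-^ E)

    ∣^*⇒∣ : ∀ E {x} → r ∣ n ^ E * x → r ∣ x
    ∣^*⇒∣ zero    {x} r∣x   = subst (r ∣_) (ℕ.+-identityʳ x) r∣x
    ∣^*⇒∣ (suc E) {x} r∣nᴱ⁺¹x = ∣^*⇒∣ E (coprime-divisor r⊥n (subst (r ∣_) (ℕ.*-assoc n (n ^ E) x) r∣nᴱ⁺¹x))

    -- Two of repunit n 0, …, repunit n r agree mod r, and their difference is n^a times a repunit.
    ∃repunit-multiple : .{{_ : NonZero r}} → ∃ λ j → r ∣ repunit n (suc j)
    ∃repunit-multiple with Fin.pigeonhole (ℕ.n<1+n r) (λ i → fromℕ< (m%n<n (repunit n (toℕ i)) r))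
    ... | i , j , i<j , same-residue = d , ∣^*⇒∣ a (%-≡⇒∣ r (repunit n a) _ (trans residues (cong (_% r) (repunit-+ n a (suc d)))))
      where
      a : ℕ
      a = toℕ i
      d : ℕ
      d = toℕ j ∸ suc a
      j≡a+1+d : toℕ j ≡ a + suc d
      j≡a+1+d = trans (sym (ℕ.m+[n∸m]≡n (ℕ.<⇒≤ i<j))) (cong (a +_) (ℕ.+-∸-assoc 1 i<j))
      residues : repunit n a % r ≡ repunit n (a + suc d) % r
      residues = trans (sym (Fin.toℕ-fromℕ< _))
                       (trans (cong toℕ same-residue) (trans (Fin.toℕ-fromℕ< _) (cong (λ t → repunit n t % r) j≡a+1+d)))

    s∣n^E : ∀ {N s} E → N ≡ s * r → {{N≢0 : NonZero N}} → s ≤ gcd (n ^ E) N → s ∣ n ^ E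
    s∣n^E {N} {s} E N≡sr {{N≢0}} s≤g = subst (_∣ n ^ E) (ℕ.≤-antisym g≤s s≤g) (gcd[m,n]∣m (n ^ E) N)
      where
      g : ℕ
      g = gcd (n ^ E) N
      g⊥r : Coprime g r
      g⊥r = Coprime.sym (λ (d∣r , d∣g) → coprime-^ E (d∣r , ∣-trans d∣g (gcd[m,n]∣m (n ^ E) N)))
      g∣s : g ∣ s
      g∣s = coprime-divisor g⊥r (subst (g ∣_) (trans N≡sr (ℕ.*-comm s r)) (gcd[m,n]∣n (n ^ E) N))
      s≢0 : NonZero s
      s≢0 = ℕ.m*n≢0⇒m≢0 s {r} {{subst NonZero N≡sr N≢0}}
      g≤s : g ≤ s
      g≤s = ∣⇒≤ {{s≢0}} g∣s

  prime⇒≥2 : ∀ {p} → Prime p → 2 ≤ p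
  prime⇒≥2 {p} pr = nonTrivial⇒n>1 p {{prime⇒nonTrivial pr}}

  prime∤! : ∀ {p} → Prime p → ∀ m → m < p → ¬ p ∣ m !
  prime∤! pr zero    m<p p∣1 = ℕ.<⇒≱ (prime⇒≥2 pr) (∣⇒≤ p∣1)
  prime∤! pr (suc m) m<p p∣m! with euclidsLemma (suc m) (m !) pr p∣m!
  ... | inj₁ p∣m+1 = ℕ.<⇒≱ m<p (∣⇒≤ p∣m+1)
  ... | inj₂ p∣m!  = prime∤! pr m (ℕ.<-trans (ℕ.n<1+n m) m<p) p∣m!

  prime∣C : ∀ {p k} → Prime p → 0 < k → k < p → p ∣ p C k
  prime∣C {p@(suc P)} {k} pr 0<k k<p with euclidsLemma (p C k) (k ! * (p ∸ k) !) pr p∣C*k![p∸k]!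
    where
    k≤p : k ≤ p
    k≤p = ℕ.<⇒≤ k<p
    C*k![p∸k]!≡p! : (p C k) * (k ! * (p ∸ k) !) ≡ p !
    C*k![p∸k]!≡p! = trans (cong (_* (k ! * (p ∸ k) !)) (nCk≡n!/k![n-k]! k≤p))
                          (m/n*n≡m {{ℕ._!*_!≢0 k (p ∸ k)}} (k![n∸k]!∣n! k≤p))
    p∣C*k![p∸k]! : p ∣ (p C k) * (k ! * (p ∸ k) !)
    p∣C*k![p∸k]! = subst (p ∣_) (sym C*k![p∸k]!≡p!) (m∣m*n (P !))
  ... | inj₁ p∣C = p∣C
  ... | inj₂ p∣k!*[p∸k]! with euclidsLemma (k !) ((p ∸ k) !) pr p∣k!*[p∸k]!
  ...   | inj₁ p∣k!     = contradiction p∣k! (prime∤! pr k k<p)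
  ...   | inj₂ p∣[p∸k]! = contradiction p∣[p∸k]! (prime∤! pr (p ∸ k) (ℕ.∸-monoʳ-< 0<k (ℕ.<⇒≤ k<p)))

  odd-prime : ∀ {p} → Prime p → p ≢ 2 → Σ ℕ (λ m → p ≡ suc (m * 2))
  odd-prime {p} pr p≢2 with p % 2 | m%n<n p 2 | m≡m%n+[m/n]*n p 2
  ... | zero        | _               | p≡[p/2]*2 with prime⇒irreducible pr (divides (p / 2) p≡[p/2]*2)
  ...   | inj₁ ()
  ...   | inj₂ 2≡p = contradiction (sym 2≡p) p≢2
  odd-prime {p} pr p≢2 | suc zero    | _               | p≡1+[p/2]*2 = p / 2 , p≡1+[p/2]*2
  odd-prime {p} pr p≢2 | suc (suc _) | s≤s (s≤s ())    | _

  [q+1]X+2≤q² : ∀ q₂ X → X ≤ q₂ → suc (suc (suc (suc (suc q₂)) * X)) ≤ suc (suc q₂) * suc (suc q₂)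
  [q+1]X+2≤q² q₂ X X≤q₂ = begin
    suc (suc (suc (suc (suc q₂)) * X))                   ≤⟨ s≤s (s≤s (ℕ.*-monoʳ-≤ (suc (suc (suc q₂))) X≤q₂)) ⟩
    suc (suc (suc (suc (suc q₂)) * q₂))                  ≤⟨ ℕ.m≤m+n _ (suc (suc q₂)) ⟩
    suc (suc (suc (suc (suc q₂)) * q₂)) + suc (suc q₂)   ≡⟨ expand q₂ ⟩
    suc (suc q₂) * suc (suc q₂)                          ∎
    where
    open ℕ.≤-Reasoning
    expand : ∀ q₂ → suc (suc (suc (suc (suc q₂)) * q₂)) + suc (suc q₂) ≡ suc (suc q₂) * suc (suc q₂)
    expand = solve-∀

open Arithmetic

-- Algebra.Solver.Ring needs a coefficient ring mapped into R; here it is ℤ. The type-checking optimised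
-- multiple _·_ makes ⟦ + 1 ⟧ reduce to 1#, so a constant con (ℤ.+ 1) is matched against 1# by refl.
module IntegerCoefficients {c ℓ} (R : CommutativeRing c ℓ) where
  open import Data.Integer using (ℤ; +_; -[1+_]; _⊖_; _◃_; sign; ∣_∣)
  import Data.Integer.Properties as ℤ
  open import Data.Maybe using (Maybe; just; nothing)
  open import Data.Sign as Sign using (Sign)
  open CommutativeRing R renaming (refl to ≈-refl; sym to ≈-sym; trans to ≈-trans)
  open import Algebra.Properties.Ring ring using (-‿involutive; -‿anti-homo-+; -0#≈0#; -1*x≈-x)
  open import Algebra.Properties.CommutativeSemigroup +-commutativeSemigroup using () renaming (interchange to +-interchange)
  open import Algebra.Properties.CommutativeSemigroup *-commutativeSemigroup using () renaming (interchange to *-interchange)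
  open import Algebra.Properties.Semiring.Mult.TCOptimised semiring using (×-homo-+; ×1-homo-*) renaming (_×_ to _·_)
  open import Algebra.Solver.Ring.AlmostCommutativeRing using (_-Raw-AlmostCommutative⟶_; fromCommutativeRing)
  open import Relation.Binary.Reasoning.Setoid setoid

  ⟦_⟧ˢ : Sign → Carrier
  ⟦ Sign.+ ⟧ˢ = 1#
  ⟦ Sign.- ⟧ˢ = - 1#

  ⟦_⟧ : ℤ → Carrier
  ⟦ + n ⟧      = n · 1#
  ⟦ -[1+ n ] ⟧ = - (suc n · 1#)

  ⟦⟧ˢ-homo-* : ∀ s t → ⟦ s Sign.* t ⟧ˢ ≈ ⟦ s ⟧ˢ * ⟦ t ⟧ˢ
  ⟦⟧ˢ-homo-* Sign.+ t      = ≈-sym (*-identityˡ _)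
  ⟦⟧ˢ-homo-* Sign.- Sign.+ = ≈-sym (*-identityʳ _)
  ⟦⟧ˢ-homo-* Sign.- Sign.- = ≈-sym (≈-trans (-1*x≈-x (- 1#)) (-‿involutive 1#))

  ⟦◃⟧ : ∀ s n → ⟦ s ◃ n ⟧ ≈ ⟦ s ⟧ˢ * (n · 1#)
  ⟦◃⟧ s      zero    = ≈-sym (zeroʳ _)
  ⟦◃⟧ Sign.+ (suc n) = ≈-sym (*-identityˡ _)
  ⟦◃⟧ Sign.- (suc n) = ≈-sym (-1*x≈-x _)

  ⟦⟧-sign-abs : ∀ i → ⟦ i ⟧ ≈ ⟦ sign i ⟧ˢ * (∣ i ∣ · 1#)
  ⟦⟧-sign-abs i = ≈-trans (reflexive (cong ⟦_⟧ (sym (ℤ.◃-inverse i)))) (⟦◃⟧ (sign i) ∣ i ∣)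

  ⟦⟧-homo-* : ∀ i j → ⟦ i ℤ.* j ⟧ ≈ ⟦ i ⟧ * ⟦ j ⟧
  ⟦⟧-homo-* i j = begin
    ⟦ i ℤ.* j ⟧                                                  ≈⟨ ⟦◃⟧ (sign i Sign.* sign j) (∣ i ∣ ℕ.* ∣ j ∣) ⟩
    ⟦ sign i Sign.* sign j ⟧ˢ * ((∣ i ∣ ℕ.* ∣ j ∣) · 1#)
      ≈⟨ *-cong (⟦⟧ˢ-homo-* (sign i) (sign j)) (×1-homo-* ∣ i ∣ ∣ j ∣) ⟩
    (⟦ sign i ⟧ˢ * ⟦ sign j ⟧ˢ) * ((∣ i ∣ · 1#) * (∣ j ∣ · 1#))     ≈⟨ *-interchange _ _ _ _ ⟩
    (⟦ sign i ⟧ˢ * (∣ i ∣ · 1#)) * (⟦ sign j ⟧ˢ * (∣ j ∣ · 1#))     ≈⟨ *-cong (⟦⟧-sign-abs i) (⟦⟧-sign-abs j) ⟨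
    ⟦ i ⟧ * ⟦ j ⟧                                                ∎

  ⟦⊖⟧ : ∀ m n → ⟦ m ⊖ n ⟧ ≈ m · 1# - n · 1#
  ⟦⊖⟧ zero    zero    = ≈-sym (≈-trans (+-congˡ -0#≈0#) (+-identityʳ 0#))
  ⟦⊖⟧ zero    (suc n) = ≈-sym (+-identityˡ _)
  ⟦⊖⟧ (suc m) zero    = ≈-sym (≈-trans (+-congˡ -0#≈0#) (+-identityʳ _))
  ⟦⊖⟧ (suc m) (suc n) = begin
    ⟦ suc m ⊖ suc n ⟧                      ≡⟨ cong ⟦_⟧ (ℤ.[1+m]⊖[1+n]≡m⊖n m n) ⟩
    ⟦ m ⊖ n ⟧                              ≈⟨ ⟦⊖⟧ m n ⟩
    m · 1# - n · 1#                        ≈⟨ +-identityˡ _ ⟨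
    0# + (m · 1# - n · 1#)                 ≈⟨ +-congʳ (-‿inverseʳ 1#) ⟨
    (1# - 1#) + (m · 1# - n · 1#)          ≈⟨ +-interchange _ _ _ _ ⟩
    (1# + m · 1#) + (- 1# - n · 1#)        ≈⟨ +-congˡ (≈-trans (-‿anti-homo-+ 1# (n · 1#)) (+-comm _ _)) ⟨
    (1# + m · 1#) - (1# + n · 1#)          ≈⟨ +-cong (×-homo-+ 1# 1 m) (-‿cong (×-homo-+ 1# 1 n)) ⟨
    suc m · 1# - suc n · 1#                ∎

  ⟦⟧-homo-+ : ∀ i j → ⟦ i ℤ.+ j ⟧ ≈ ⟦ i ⟧ + ⟦ j ⟧
  ⟦⟧-homo-+ -[1+ m ] -[1+ n ] = begin
    - (suc (suc (m ℕ.+ n)) · 1#)           ≡⟨ cong (λ k → - (suc k · 1#)) (ℕ.+-suc m n) ⟨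
    - ((suc m ℕ.+ suc n) · 1#)             ≈⟨ -‿cong (×-homo-+ 1# (suc m) (suc n)) ⟩
    - (suc m · 1# + suc n · 1#)            ≈⟨ -‿anti-homo-+ _ _ ⟩
    - (suc n · 1#) - (suc m · 1#)          ≈⟨ +-comm _ _ ⟩
    - (suc m · 1#) - (suc n · 1#)          ∎
  ⟦⟧-homo-+ -[1+ m ] (+ n)    = ≈-trans (⟦⊖⟧ n (suc m)) (+-comm _ _)
  ⟦⟧-homo-+ (+ m)    -[1+ n ] = ⟦⊖⟧ m (suc n)
  ⟦⟧-homo-+ (+ m)    (+ n)    = ×-homo-+ 1# m n

  ⟦⟧-homo-neg : ∀ i → ⟦ ℤ.- i ⟧ ≈ - ⟦ i ⟧
  ⟦⟧-homo-neg (+ zero)  = ≈-sym -0#≈0#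
  ⟦⟧-homo-neg (+ suc n) = ≈-refl
  ⟦⟧-homo-neg -[1+ n ]  = ≈-sym (-‿involutive _)

  integerMorphism : ℤ.+-*-rawRing -Raw-AlmostCommutative⟶ fromCommutativeRing R
  integerMorphism = record
    { ⟦_⟧    = ⟦_⟧
    ; +-homo = ⟦⟧-homo-+
    ; *-homo = ⟦⟧-homo-*
    ; -‿homo = ⟦⟧-homo-neg
    ; 0-homo = ≈-refl
    ; 1-homo = ≈-refl
    }

  ⟦⟧-equal? : ∀ i j → Maybe (⟦ i ⟧ ≈ ⟦ j ⟧)
  ⟦⟧-equal? i j with i ℤ.≟ j
  ... | yes i≡j = just (reflexive (cong ⟦_⟧ i≡j))
  ... | no _    = nothing

  open import Algebra.Solver.Ring ℤ.+-*-rawRing (fromCommutativeRing R) integerMorphism ⟦⟧-equal? public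
    using (solve; _:=_; _:+_; _:*_; :-_; _:-_; con)

module FieldProperties (F : FiniteField) where
  open FiniteField F public

  commutativeRing : CommutativeRing 0ℓ 0ℓ
  commutativeRing = record { isCommutativeRing = isCommutativeRing }

  open CommutativeRing commutativeRing public
    using ( +-comm; *-assoc; *-comm; +-identityˡ; +-identityʳ; *-identityˡ; *-identityʳ; -‿inverseʳ
          ; zeroˡ; zeroʳ; semiring; +-commutativeMonoid; *-commutativeMonoid )
  open CommutativeRing commutativeRing using (ring; *-commutativeSemigroup)
  open import Algebra.Properties.Ring ring public
    using (-‿distribˡ-*; -‿distribʳ-*; +-identityʳ-unique; +-inverseʳ-unique)
    renaming (x∙y⁻¹≈ε⇒x≈y to x-y≡0⇒x≡y)
  open import Algebra.Properties.CommutativeSemigroup *-commutativeSemigroup public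
    using () renaming (interchange to *-interchange)
  open import Algebra.Properties.Semiring.Mult semiring public using (×1-homo-*) renaming (_×_ to _·_)
  open IntegerCoefficients commutativeRing public using (solve; _:=_; _:+_; _:*_; :-_; _:-_; con)
  open ≡-Reasoning

  element : Fin size → Carrier
  element = Inverse.from enum

  index : Carrier → Fin size
  index = Inverse.to enum

  index-element : ∀ i → index (element i) ≡ i
  index-element = Inverse.strictlyInverseˡ enum

  element-index : ∀ x → element (index x) ≡ x
  element-index = Inverse.strictlyInverseʳ enum

  infix 4 _≟_
  _≟_ : DecidableEquality Carrier
  _≟_ = Fin.inj⇒≟ (↔⇒↣ enum)

  1≢0 : 1# ≢ 0#
  1≢0 = 0≢1 ∘ sym

  inv : (x : Carrier) → x ≢ 0# → Carrier
  inv x x≢0 = proj₁ (inverse x x≢0)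

  inverseʳ : ∀ x (x≢0 : x ≢ 0#) → x * inv x x≢0 ≡ 1#
  inverseʳ x x≢0 = proj₂ (inverse x x≢0)

  inverseˡ : ∀ x (x≢0 : x ≢ 0#) → inv x x≢0 * x ≡ 1#
  inverseˡ x x≢0 = trans (*-comm _ _) (inverseʳ x x≢0)

  *-cancelˡ : ∀ {x y z} → x ≢ 0# → x * y ≡ x * z → y ≡ z
  *-cancelˡ {x} {y} {z} x≢0 xy≡xz = begin
    y                    ≡⟨ sym (*-identityˡ y) ⟩
    1# * y               ≡⟨ cong (_* y) (inverseˡ x x≢0) ⟨
    (inv x x≢0 * x) * y  ≡⟨ *-assoc _ _ _ ⟩
    inv x x≢0 * (x * y)  ≡⟨ cong (inv x x≢0 *_) xy≡xz ⟩
    inv x x≢0 * (x * z)  ≡⟨ *-assoc _ _ _ ⟨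
    (inv x x≢0 * x) * z  ≡⟨ cong (_* z) (inverseˡ x x≢0) ⟩
    1# * z               ≡⟨ *-identityˡ z ⟩
    z                    ∎

  *-cancelʳ : ∀ {x y z} → x ≢ 0# → y * x ≡ z * x → y ≡ z
  *-cancelʳ x≢0 yx≡zx = *-cancelˡ x≢0 (trans (*-comm _ _) (trans yx≡zx (*-comm _ _)))

  *-≢0 : ∀ {x y} → x ≢ 0# → y ≢ 0# → x * y ≢ 0#
  *-≢0 {x} x≢0 y≢0 xy≡0 = y≢0 (*-cancelˡ x≢0 (trans xy≡0 (sym (zeroʳ x))))

  x*y≡0⇒x≡0⊎y≡0 : ∀ {x y} → x * y ≡ 0# → x ≡ 0# ⊎ y ≡ 0#
  x*y≡0⇒x≡0⊎y≡0 {x} xy≡0 with x ≟ 0#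
  ... | yes x≡0 = inj₁ x≡0
  ... | no x≢0  = inj₂ (*-cancelˡ x≢0 (trans xy≡0 (sym (zeroʳ x))))

  ^-distribˡ-+-* : ∀ x a b → x ^ (a ℕ.+ b) ≡ x ^ a * x ^ b
  ^-distribˡ-+-* x zero    b = sym (*-identityˡ _)
  ^-distribˡ-+-* x (suc a) b = trans (cong (x *_) (^-distribˡ-+-* x a b)) (sym (*-assoc _ _ _))

  ^-distribʳ-* : ∀ x y m → (x * y) ^ m ≡ x ^ m * y ^ m
  ^-distribʳ-* x y zero    = sym (*-identityˡ 1#)
  ^-distribʳ-* x y (suc m) = trans (cong ((x * y) *_) (^-distribʳ-* x y m)) (*-interchange x y _ _)

  1^m≡1 : ∀ m → 1# ^ m ≡ 1#
  1^m≡1 zero    = refl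
  1^m≡1 (suc m) = trans (*-identityˡ _) (1^m≡1 m)

  ^-*-assoc : ∀ x a b → (x ^ a) ^ b ≡ x ^ (a ℕ.* b)
  ^-*-assoc x zero    b = 1^m≡1 b
  ^-*-assoc x (suc a) b = begin
    (x * x ^ a) ^ b        ≡⟨ ^-distribʳ-* x (x ^ a) b ⟩
    x ^ b * (x ^ a) ^ b    ≡⟨ cong (x ^ b *_) (^-*-assoc x a b) ⟩
    x ^ b * x ^ (a ℕ.* b)  ≡⟨ ^-distribˡ-+-* x b (a ℕ.* b) ⟨
    x ^ (b ℕ.+ a ℕ.* b)    ∎

  ^-comm : ∀ x a b → (x ^ a) ^ b ≡ (x ^ b) ^ a
  ^-comm x a b = trans (^-*-assoc x a b) (trans (cong (x ^_) (ℕ.*-comm a b)) (sym (^-*-assoc x b a)))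

  ^-≢0 : ∀ {x} m → x ≢ 0# → x ^ m ≢ 0#
  ^-≢0 zero    x≢0 = 1≢0
  ^-≢0 (suc m) x≢0 = *-≢0 x≢0 (^-≢0 m x≢0)

  ^≡0⇒≡0 : ∀ {x} m → x ^ m ≡ 0# → x ≡ 0#
  ^≡0⇒≡0 {x} m xᵐ≡0 with x ≟ 0#
  ... | yes x≡0 = x≡0
  ... | no x≢0  = ⊥-elim (^-≢0 m x≢0 xᵐ≡0)

  ^≡1⇒^*≡1 : ∀ {x} N → x ^ N ≡ 1# → ∀ t → x ^ (N ℕ.* t) ≡ 1#
  ^≡1⇒^*≡1 {x} N xᴺ≡1 t = trans (sym (^-*-assoc x N t)) (trans (cong (_^ t) xᴺ≡1) (1^m≡1 t))

  ^≡1-cancel-+ : ∀ {u} g c → u ^ c ≡ 1# → u ^ (g ℕ.+ c) ≡ 1# → u ^ g ≡ 1#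
  ^≡1-cancel-+ {u} g c uᶜ≡1 uᵍ⁺ᶜ≡1 = begin
    u ^ g             ≡⟨ *-identityʳ _ ⟨
    u ^ g * 1#        ≡⟨ cong (u ^ g *_) uᶜ≡1 ⟨
    u ^ g * u ^ c     ≡⟨ ^-distribˡ-+-* u g c ⟨
    u ^ (g ℕ.+ c)     ≡⟨ uᵍ⁺ᶜ≡1 ⟩
    1#                ∎

  ^-gcd : ∀ {u} a b → u ^ a ≡ 1# → u ^ b ≡ 1# → u ^ gcd a b ≡ 1#
  ^-gcd {u} a b uᵃ≡1 uᵇ≡1 with Bézout.identity (gcd-GCD a b)
  ... | Bézout.+- x y g+yb≡xa = ^≡1-cancel-+ (gcd a b) (y ℕ.* b) (trans (cong (u ^_) (ℕ.*-comm y b)) (^≡1⇒^*≡1 b uᵇ≡1 y))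
                                  (trans (cong (u ^_) (trans g+yb≡xa (ℕ.*-comm x a))) (^≡1⇒^*≡1 a uᵃ≡1 x))
  ... | Bézout.-+ x y g+xa≡yb = ^≡1-cancel-+ (gcd a b) (x ℕ.* a) (trans (cong (u ^_) (ℕ.*-comm x a)) (^≡1⇒^*≡1 a uᵃ≡1 x))
                                  (trans (cong (u ^_) (trans g+xa≡yb (ℕ.*-comm y b))) (^≡1⇒^*≡1 b uᵇ≡1 y))

module FieldCounting (F : FiniteField) where
  open FieldProperties F
  open ≡-Reasoning

  module _ {c ℓ} (M : CommutativeMonoid c ℓ) where
    open CommutativeMonoid M using (_≈_) renaming (Carrier to A; trans to ≈-trans; reflexive to ≈-reflexive)
    open import Algebra.Properties.CommutativeMonoid.Sum M using (sum; ∑-permute; sum-cong-≗)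

    ∑-reindex : (σ : Carrier ↔ Carrier) (g : Carrier → A) →
                sum (g ∘ element) ≈ sum (g ∘ Inverse.to σ ∘ element)
    ∑-reindex σ g = ≈-trans (∑-permute (g ∘ element) (enum ↔-∘ (σ ↔-∘ ↔-sym enum)))
                          (≈-reflexive (sum-cong-≗ (cong g ∘ element-index ∘ Inverse.to σ ∘ element)))

  +-translation : Carrier → Carrier ↔ Carrier
  +-translation a = mk↔ₛ′ (_+ a) (_- a) cancel cancel′
    where
    cancel : ∀ x → (x - a) + a ≡ x
    cancel x = solve 2 (λ x a → (x :- a) :+ a := x) refl x a
    cancel′ : ∀ x → (x + a) - a ≡ x
    cancel′ x = solve 2 (λ x a → (x :+ a) :- a := x) refl x a

  *-scaling : (y : Carrier) → y ≢ 0# → Carrier ↔ Carrier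
  *-scaling y y≢0 = mk↔ₛ′ (y *_) (inv y y≢0 *_) (cancel (inverseʳ y y≢0)) (cancel (inverseˡ y y≢0))
    where
    cancel : ∀ {u v} → u * v ≡ 1# → ∀ x → u * (v * x) ≡ x
    cancel {u} {v} uv≡1 x = trans (sym (*-assoc u v x)) (trans (cong (_* x) uv≡1) (*-identityˡ x))

  open import Algebra.Properties.CommutativeMonoid.Sum +-commutativeMonoid
    using (∑-distrib-+; sum-replicate) renaming (sum to ∑)
  open import Algebra.Properties.CommutativeMonoid.Sum *-commutativeMonoid
    using () renaming (sum to ∏; ∑-distrib-+ to ∏-distrib-*; sum-cong-≗ to ∏-cong)

  characteristic : size · 1# ≡ 0#
  characteristic = +-identityʳ-unique S (size · 1#) (sym (begin
    S                                  ≡⟨ ∑-reindex +-commutativeMonoid (+-translation 1#) id ⟩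
    ∑ (λ i → element i + 1#)           ≡⟨ ∑-distrib-+ element (λ _ → 1#) ⟩
    S + ∑ {size} (λ _ → 1#)            ≡⟨ cong (S +_) (sum-replicate size) ⟩
    S + size · 1#                      ∎))
    where
    S : Carrier
    S = ∑ element

  ∏-const : ∀ n y → ∏ {n} (λ _ → y) ≡ y ^ n
  ∏-const zero    y = refl
  ∏-const (suc n) y = cong (y *_) (∏-const n y)

  ∏-≢0 : ∀ {n} (t : Fin n → Carrier) → (∀ i → t i ≢ 0#) → ∏ t ≢ 0#
  ∏-≢0 {zero}  t t≢0 = 1≢0
  ∏-≢0 {suc n} t t≢0 = *-≢0 (t≢0 Fin.zero) (∏-≢0 (t ∘ Fin.suc) (t≢0 ∘ Fin.suc))

  ∏-ones : ∀ {n} (t : Fin n → Carrier) → (∀ i → t i ≡ 1#) → ∏ t ≡ 1#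
  ∏-ones {zero}  t t≡1 = refl
  ∏-ones {suc n} t t≡1 = trans (cong₂ _*_ (t≡1 Fin.zero) (∏-ones (t ∘ Fin.suc) (t≡1 ∘ Fin.suc))) (*-identityˡ 1#)

  ∏-single : ∀ {n} (i₀ : Fin n) (t : Fin n → Carrier) → (∀ i → i ≢ i₀ → t i ≡ 1#) → ∏ t ≡ t i₀
  ∏-single Fin.zero     t t≡1 = trans (cong (t Fin.zero *_) (∏-ones (t ∘ Fin.suc) (λ i → t≡1 (Fin.suc i) λ ()))) (*-identityʳ _)
  ∏-single (Fin.suc i₀) t t≡1 =
    trans (cong₂ _*_ (t≡1 Fin.zero λ ()) (∏-single i₀ (t ∘ Fin.suc) (λ i i≢i₀ → t≡1 (Fin.suc i) (i≢i₀ ∘ Fin.suc-injective))))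
          (*-identityˡ _)

  0^n≡0 : ∀ {n} → Fin n → 0# ^ n ≡ 0#
  0^n≡0 {suc n} _ = zeroˡ _

  -- The product of unit x over all x is invariant under x ↦ y x. Factorwise, y * unit x and unit (y x)
  -- differ by the factor atZero x, which is y at x = 0 and 1 elsewhere.
  fermat : ∀ y → y ^ size ≡ y
  fermat y with y ≟ 0#
  ... | yes refl = 0^n≡0 (index 0#)
  ... | no y≢0  = *-cancelʳ (∏-≢0 (unit ∘ element) (unit≢0 ∘ element)) (begin
    y ^ size * G                                       ≡⟨ cong (_* G) (∏-const size y) ⟨
    ∏ {size} (λ _ → y) * G                             ≡⟨ ∏-distrib-* (λ _ → y) (unit ∘ element) ⟨
    ∏ (λ i → y * unit (element i))                     ≡⟨ ∏-cong (scale-unit ∘ element) ⟩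
    ∏ (λ i → unit (y * element i) * atZero (element i)) ≡⟨ ∏-distrib-* (unit ∘ (y *_) ∘ element) (atZero ∘ element) ⟩
    ∏ (unit ∘ (y *_) ∘ element) * ∏ (atZero ∘ element) ≡⟨ cong₂ _*_ (sym (∑-reindex *-commutativeMonoid (*-scaling y y≢0) unit)) ∏atZero ⟩
    G * y                                              ≡⟨ *-comm G y ⟩
    y * G                                              ∎)
    where
    unit : Carrier → Carrier
    unit x with x ≟ 0#
    ... | yes _ = 1#
    ... | no _  = x

    unit≢0 : ∀ x → unit x ≢ 0#
    unit≢0 x with x ≟ 0#
    ... | yes _  = 1≢0
    ... | no x≢0 = x≢0

    atZero : Carrier → Carrier
    atZero x with x ≟ 0#
    ... | yes _ = y
    ... | no _  = 1#

    G : Carrier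
    G = ∏ (unit ∘ element)

    scale-unit : ∀ x → y * unit x ≡ unit (y * x) * atZero x
    scale-unit x with x ≟ 0# | (y * x) ≟ 0#
    ... | yes _    | yes _     = trans (*-identityʳ y) (sym (*-identityˡ y))
    ... | yes x≡0  | no yx≢0   = ⊥-elim (yx≢0 (trans (cong (y *_) x≡0) (zeroʳ y)))
    ... | no x≢0   | yes yx≡0  = ⊥-elim (*-≢0 y≢0 x≢0 yx≡0)
    ... | no _     | no _      = sym (*-identityʳ _)

    atZero-0 : atZero 0# ≡ y
    atZero-0 with 0# ≟ 0#
    ... | yes _   = refl
    ... | no 0≢0  = ⊥-elim (0≢0 refl)

    atZero-≢0 : ∀ i → i ≢ index 0# → atZero (element i) ≡ 1#
    atZero-≢0 i i≢i₀ with element i ≟ 0#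
    ... | yes eᵢ≡0 = ⊥-elim (i≢i₀ (trans (sym (index-element i)) (cong index eᵢ≡0)))
    ... | no _     = refl

    ∏atZero : ∏ (atZero ∘ element) ≡ y
    ∏atZero = trans (∏-single (index 0#) (atZero ∘ element) atZero-≢0) (trans (cong atZero (element-index 0#)) atZero-0)

module Frobenius (F : FiniteField) where
  open FieldProperties F
  open CommutativeRing commutativeRing using (commutativeSemiring)
  open import Algebra.Properties.CommutativeSemiring.Binomial commutativeSemiring
    using (theorem; binomialTerm)
  open import Algebra.Properties.Semiring.Exp semiring using () renaming (_^_ to _^ᴿ_)
  open import Algebra.Properties.Semiring.Mult semiring using (×-assoc-*)
  open import Algebra.Properties.Monoid.Sum (CommutativeRing.+-monoid commutativeRing)
    using (sum; sum-init-last; sum-cong-≗; sum-replicate-zero)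
  open ≡-Reasoning

  ^ᴿ≡^ : ∀ x n → x ^ᴿ n ≡ x ^ n
  ^ᴿ≡^ x zero    = refl
  ^ᴿ≡^ x (suc n) = cong (x *_) (^ᴿ≡^ x n)

  module _ {p} (char : p · 1# ≡ 0#) where

    p∣m⇒m·z≡0 : ∀ {m} z → p ∣ m → m · z ≡ 0#
    p∣m⇒m·z≡0 {m} z (divides d refl) = begin
      (d ℕ.* p) · z              ≡⟨ cong ((d ℕ.* p) ·_) (*-identityˡ z) ⟨
      (d ℕ.* p) · (1# * z)       ≡⟨ ×-assoc-* (d ℕ.* p) 1# z ⟨
      (d ℕ.* p) · 1# * z         ≡⟨ cong (_* z) (×1-homo-* d p) ⟩
      (d · 1#) * (p · 1#) * z    ≡⟨ cong (λ c → (d · 1#) * c * z) char ⟩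
      (d · 1#) * 0# * z          ≡⟨ cong (_* z) (zeroʳ _) ⟩
      0# * z                     ≡⟨ zeroˡ z ⟩
      0#                         ∎

    frobenius : Prime p → ∀ x y → (x + y) ^ p ≡ x ^ p + y ^ p
    frobenius pr x y with prime⇒≥2 pr
    ... | s≤s (s≤s {n = P} _) = begin
      (x + y) ^ p                                           ≡⟨ ^ᴿ≡^ (x + y) p ⟨
      (x + y) ^ᴿ p                                          ≡⟨ theorem p x y ⟩
      term Fin.zero + sum (term ∘ Fin.suc)                  ≡⟨ cong (term Fin.zero +_) (sum-init-last (term ∘ Fin.suc)) ⟩
      term Fin.zero + (sum (term ∘ Fin.suc ∘ inject₁) + term (fromℕ p))
                                                            ≡⟨ cong₂ _+_ first (cong₂ _+_ middle last) ⟩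
      y ^ p + (0# + x ^ p)                                  ≡⟨ cong (y ^ p +_) (+-identityˡ _) ⟩
      y ^ p + x ^ p                                         ≡⟨ +-comm _ _ ⟩
      x ^ p + y ^ p                                         ∎
      where
      term : Fin (suc p) → Carrier
      term = binomialTerm x y p

      first : term Fin.zero ≡ y ^ p
      first = trans (+-identityʳ _) (trans (*-identityˡ _) (^ᴿ≡^ y p))

      middle : sum (term ∘ Fin.suc ∘ inject₁) ≡ 0#
      middle = trans (sum-cong-≗ vanishes) (sum-replicate-zero (suc P))
        where
        vanishes : ∀ i → term (Fin.suc (inject₁ i)) ≡ 0#
        vanishes i = p∣m⇒m·z≡0 _ (prime∣C pr (s≤s z≤n) (s≤s (subst (_< suc P) (sym (Fin.toℕ-inject₁ i)) (Fin.toℕ<n i))))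

      last : term (fromℕ p) ≡ x ^ p
      last = begin
        term (fromℕ p)                    ≡⟨ cong (λ k → (p C k) · (x ^ᴿ k * y ^ᴿ (p ∸ k))) (Fin.toℕ-fromℕ p) ⟩
        (p C p) · (x ^ᴿ p * y ^ᴿ (p ∸ p))  ≡⟨ cong₂ (λ c k → c · (x ^ᴿ p * y ^ᴿ k)) (nCn≡1 p) (ℕ.n∸n≡0 p) ⟩
        1 · (x ^ᴿ p * 1#)                 ≡⟨ trans (+-identityʳ _) (*-identityʳ _) ⟩
        x ^ᴿ p                            ≡⟨ ^ᴿ≡^ x p ⟩
        x ^ p                             ∎

    frobenius-^ : Prime p → ∀ j x y → (x + y) ^ (p ^ℕ j) ≡ x ^ (p ^ℕ j) + y ^ (p ^ℕ j)
    frobenius-^ pr zero    x y = trans (*-identityʳ _) (sym (cong₂ _+_ (*-identityʳ x) (*-identityʳ y)))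
    frobenius-^ pr (suc j) x y = begin
      (x + y) ^ (p ℕ.* p ^ℕ j)                  ≡⟨ ^-*-assoc (x + y) p (p ^ℕ j) ⟨
      ((x + y) ^ p) ^ (p ^ℕ j)                  ≡⟨ cong (_^ (p ^ℕ j)) (frobenius pr x y) ⟩
      (x ^ p + y ^ p) ^ (p ^ℕ j)                ≡⟨ frobenius-^ pr j (x ^ p) (y ^ p) ⟩
      (x ^ p) ^ (p ^ℕ j) + (y ^ p) ^ (p ^ℕ j)   ≡⟨ cong₂ _+_ (^-*-assoc x p _) (^-*-assoc y p _) ⟩
      x ^ (p ℕ.* p ^ℕ j) + y ^ (p ℕ.* p ^ℕ j)   ∎

module Polynomials (F : FiniteField) where
  open FieldProperties F
  open ≡-Reasoning

  eval : ∀ {m} → Vec Carrier m → Carrier → Carrier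
  eval []      x = 0#
  eval (a ∷ v) x = a + x * eval v x

  leading : ∀ {m} → Vec Carrier (suc m) → Carrier
  leading (a ∷ [])    = a
  leading (a ∷ b ∷ v) = leading (b ∷ v)

  divideBy : ∀ {m} → Carrier → Vec Carrier (suc m) → Vec Carrier m
  divideBy r (a ∷ [])    = []
  divideBy r (a ∷ b ∷ v) = eval (b ∷ v) r ∷ divideBy r (b ∷ v)

  eval-divideBy : ∀ {m} r (v : Vec Carrier (suc m)) x → eval v x ≡ (x - r) * eval (divideBy r v) x + eval v r
  eval-divideBy r (a ∷ [])    x = solve 3 (λ a x r → a :+ x :* con (ℤ.+ 0) := (x :- r) :* con (ℤ.+ 0) :+ (a :+ r :* con (ℤ.+ 0))) refl a x r
  eval-divideBy r (a ∷ b ∷ v) x = begin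
    a + x * eval (b ∷ v) x               ≡⟨ cong (λ t → a + x * t) (eval-divideBy r (b ∷ v) x) ⟩
    a + x * ((x - r) * Q + R)
      ≡⟨ solve 5 (λ a x r Q R → a :+ x :* ((x :- r) :* Q :+ R) := (x :- r) :* (R :+ x :* Q) :+ (a :+ r :* R)) refl a x r Q R ⟩
    (x - r) * (R + x * Q) + (a + r * R)  ∎
    where
    Q : Carrier
    Q = eval (divideBy r (b ∷ v)) x
    R : Carrier
    R = eval (b ∷ v) r

  leading-divideBy : ∀ {m} r (v : Vec Carrier (suc (suc m))) → leading (divideBy r v) ≡ leading v
  leading-divideBy r (a ∷ b ∷ [])    = trans (cong (b +_) (zeroʳ r)) (+-identityʳ b)
  leading-divideBy r (a ∷ b ∷ c ∷ v) = leading-divideBy r (b ∷ c ∷ v)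

  monic-roots-bounded : ∀ d (v : Vec Carrier (suc d)) → leading v ≡ 1# →
                        (ρ : Fin (suc d) → Carrier) → Injective _≡_ _≡_ ρ → ¬ (∀ i → eval v (ρ i) ≡ 0#)
  monic-roots-bounded zero    (a ∷ []) monic ρ ρ-inj roots =
    1≢0 (trans (sym monic) (trans (sym (trans (cong (a +_) (zeroʳ _)) (+-identityʳ a))) (roots Fin.zero)))
  monic-roots-bounded (suc d) v        monic ρ ρ-inj roots =
    monic-roots-bounded d (divideBy r v) (trans (leading-divideBy r v) monic) (ρ ∘ Fin.suc)
                        (Fin.suc-injective ∘ ρ-inj) quotient-roots
    where
    r : Carrier
    r = ρ Fin.zero
    factored : ∀ i → (ρ (Fin.suc i) - r) * eval (divideBy r v) (ρ (Fin.suc i)) ≡ 0#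
    factored i = begin
      (x - r) * eval (divideBy r v) x            ≡⟨ +-identityʳ _ ⟨
      (x - r) * eval (divideBy r v) x + 0#       ≡⟨ cong ((x - r) * eval (divideBy r v) x +_) (roots Fin.zero) ⟨
      (x - r) * eval (divideBy r v) x + eval v r ≡⟨ eval-divideBy r v x ⟨
      eval v x                                   ≡⟨ roots (Fin.suc i) ⟩
      0#                                         ∎
      where
        x : Carrier
        x = ρ (Fin.suc i)
    quotient-roots : ∀ i → eval (divideBy r v) (ρ (Fin.suc i)) ≡ 0#
    quotient-roots i with x*y≡0⇒x≡0⊎y≡0 (factored i)
    ... | inj₂ root = root
    ... | inj₁ x-r≡0 = contradiction (ρ-inj (x-y≡0⇒x≡y _ _ x-r≡0)) λ ()

  monomial : ∀ m → Vec Carrier (suc m)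
  monomial zero    = 1# ∷ []
  monomial (suc m) = 0# ∷ monomial m

  eval-monomial : ∀ m x → eval (monomial m) x ≡ x ^ m
  eval-monomial zero    x = trans (cong (1# +_) (zeroʳ x)) (+-identityʳ 1#)
  eval-monomial (suc m) x = trans (+-identityˡ _) (cong (x *_) (eval-monomial m x))

  leading-∷ : ∀ {m} a (v : Vec Carrier (suc m)) → leading (a ∷ v) ≡ leading v
  leading-∷ a (b ∷ v) = refl

  leading-monomial : ∀ m → leading (monomial m) ≡ 1#
  leading-monomial zero    = refl
  leading-monomial (suc m) = trans (leading-∷ 0# (monomial m)) (leading-monomial m)

  ¬∀y^m≡y : ∀ m → 2 ≤ m → suc m ≤ size → ¬ (∀ y → y ^ m ≡ y)
  ¬∀y^m≡y (suc (suc d)) (s≤s (s≤s _)) m<size all-fixed = monic-roots-bounded (suc (suc d)) P monic ρ ρ-injective roots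
    where
    P : Vec Carrier (suc (suc (suc d)))
    P = 0# ∷ - 1# ∷ monomial d
    monic : leading P ≡ 1#
    monic = trans (leading-∷ (- 1#) (monomial d)) (leading-monomial d)
    eval-P : ∀ x → eval P x ≡ x ^ suc (suc d) - x
    eval-P x = begin
      0# + x * (- 1# + x * eval (monomial d) x)
        ≡⟨ cong (λ t → 0# + x * (- 1# + x * t)) (eval-monomial d x) ⟩
      0# + x * (- 1# + x * x ^ d)
        ≡⟨ solve 2 (λ x y → con (ℤ.+ 0) :+ x :* (:- con (ℤ.+ 1) :+ x :* y) := x :* (x :* y) :- x) refl x (x ^ d) ⟩
      x * (x * x ^ d) - x
        ∎
    ρ : Fin (suc (suc (suc d))) → Carrier
    ρ i = element (inject≤ i m<size)
    ρ-injective : Injective _≡_ _≡_ ρ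
    ρ-injective {i} {j} ρi≡ρj =
      Fin.inject≤-injective m<size m<size i j (trans (sym (index-element _)) (trans (cong index ρi≡ρj) (index-element _)))
    roots : ∀ i → eval P (ρ i) ≡ 0#
    roots i = trans (eval-P (ρ i)) (trans (cong (_- ρ i) (all-fixed (ρ i))) (-‿inverseʳ (ρ i)))

  ∃y^m≢y : ∀ m → 2 ≤ m → suc m ≤ size → Σ Carrier (λ y → y ^ m ≢ y)
  ∃y^m≢y m 2≤m m<size with Fin.¬∀⟶∃¬ size (λ i → element i ^ m ≡ element i) (λ i → element i ^ m ≟ element i) not-all
    where
    not-all : ¬ (∀ i → element i ^ m ≡ element i)
    not-all all-fixed = ¬∀y^m≡y m 2≤m m<size (λ y → subst (λ y → y ^ m ≡ y) (element-index y) (all-fixed (index y)))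
  ... | i , eᵢ^m≢eᵢ = element i , eᵢ^m≢eᵢ

module MonomialMap (F : FiniteField) (m : ℕ) (δ₁ δ₂ : FiniteField.Carrier F)
                   (δ₁≢0 : δ₁ ≢ FiniteField.0# F) (δ₂≢0 : δ₂ ≢ FiniteField.0# F) where
  open FieldProperties F
  open ≡-Reasoning

  n : ℕ
  n = suc (suc m)

  T : Carrier × Carrier → Carrier × Carrier
  T (α , γ) = δ₁ * γ ^ n , δ₂ * α * γ ^ suc m

  Invertible : Carrier × Carrier → Set
  Invertible (α , γ) = α ≢ 0# × γ ≢ 0#

  Degenerate : Carrier × Carrier → Set
  Degenerate (α , γ) = α ≡ 0# ⊎ γ ≡ 0#

  invertible⊎degenerate : ∀ x → Invertible x ⊎ Degenerate x
  invertible⊎degenerate (α , γ) with α ≟ 0# | γ ≟ 0#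
  ... | yes α≡0 | _       = inj₂ (inj₁ α≡0)
  ... | no _    | yes γ≡0 = inj₂ (inj₂ γ≡0)
  ... | no α≢0  | no γ≢0  = inj₁ (α≢0 , γ≢0)

  T-Invertible : ∀ {x} → Invertible x → Invertible (T x)
  T-Invertible (α≢0 , γ≢0) = *-≢0 δ₁≢0 (^-≢0 n γ≢0) , *-≢0 (*-≢0 δ₂≢0 α≢0) (^-≢0 (suc m) γ≢0)

  iter-T-Invertible : ∀ i {x} → Invertible x → Invertible (iter T i x)
  iter-T-Invertible zero    inv-x = inv-x
  iter-T-Invertible (suc i) inv-x = T-Invertible (iter-T-Invertible i inv-x)

  T-zeroʳ : ∀ α → T (α , 0#) ≡ (0# , 0#)
  T-zeroʳ α = cong₂ _,_ (trans (cong (δ₁ *_) (zeroˡ _)) (zeroʳ δ₁)) (trans (cong (δ₂ * α *_) (zeroˡ _)) (zeroʳ _))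

  T-zeroˡ : ∀ γ → proj₂ (T (0# , γ)) ≡ 0#
  T-zeroˡ γ = trans (cong (_* γ ^ suc m) (zeroʳ δ₂)) (zeroˡ _)

  T²-Degenerate : ∀ x → Degenerate x → T (T x) ≡ (0# , 0#)
  T²-Degenerate (α , γ) (inj₁ refl) = trans (cong (λ t → T (proj₁ (T (0# , γ)) , t)) (T-zeroˡ γ)) (T-zeroʳ _)
  T²-Degenerate (α , γ) (inj₂ refl) = trans (cong T (T-zeroʳ α)) (T-zeroʳ 0#)

  iter-T-Degenerate : ∀ l x → Degenerate x → iter T (l ℕ.+ 2) x ≡ (0# , 0#)
  iter-T-Degenerate l x deg = trans (iter-+ T l 2 x) (trans (cong (iter T l) (T²-Degenerate x deg)) (iter-fix (T-zeroʳ 0#) l))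

  ψ : Carrier × Carrier → Carrier
  ψ (α , γ) = α * γ ^ n

  κ : Carrier
  κ = δ₁ * δ₂ ^ n

  h : Carrier → Carrier
  h P = κ * P ^ n

  ψ-Invertible : ∀ {x} → Invertible x → ψ x ≢ 0#
  ψ-Invertible (α≢0 , γ≢0) = *-≢0 α≢0 (^-≢0 n γ≢0)

  ψ-semiconj : ∀ x → ψ (T x) ≡ h (ψ x)
  ψ-semiconj (α , γ) = begin
    δ₁ * (γ * G) * (δ₂ * α * G) ^ n
      ≡⟨ cong (δ₁ * (γ * G) *_) (trans (^-distribʳ-* _ _ n) (cong (_* G ^ n) (^-distribʳ-* _ _ n))) ⟩
    δ₁ * (γ * G) * (δ₂ ^ n * α ^ n * G ^ n)
      ≡⟨ solve 6 (λ d₁ g G d₂ⁿ aⁿ Gⁿ → d₁ :* (g :* G) :* (d₂ⁿ :* aⁿ :* Gⁿ) := d₁ :* d₂ⁿ :* (aⁿ :* ((g :* G) :* Gⁿ)))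
                 refl δ₁ γ G (δ₂ ^ n) (α ^ n) (G ^ n) ⟩
    δ₁ * δ₂ ^ n * (α ^ n * ((γ * G) * G ^ n))      ≡⟨ cong (λ t → κ * (α ^ n * t)) (^-distribʳ-* γ G n) ⟨
    δ₁ * δ₂ ^ n * (α ^ n * (γ * G) ^ n)            ≡⟨ cong (κ *_) (^-distribʳ-* α (γ * G) n) ⟨
    δ₁ * δ₂ ^ n * (α * (γ * G)) ^ n                ∎
    where
      G : Carrier
      G = γ ^ suc m

  iter-ψ : ∀ i x → ψ (iter T i x) ≡ iter h i (ψ x)
  iter-ψ = iter-semiconj T h ψ ψ-semiconj

  Periodic-ψ : ∀ {x} → Periodic T x → Periodic h (ψ x)
  Periodic-ψ = Periodic-semiconj T h ψ ψ-semiconj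

  scale : Carrier → Carrier × Carrier → Carrier × Carrier
  scale ζ (α , γ) = ζ * α , ζ * γ

  scale-1 : ∀ x → scale 1# x ≡ x
  scale-1 (α , γ) = cong₂ _,_ (*-identityˡ α) (*-identityˡ γ)

  scale-scale : ∀ ζ ξ x → scale ζ (scale ξ x) ≡ scale (ζ * ξ) x
  scale-scale ζ ξ (α , γ) = cong₂ _,_ (sym (*-assoc ζ ξ α)) (sym (*-assoc ζ ξ γ))

  T-scale : ∀ ζ x → T (scale ζ x) ≡ scale (ζ ^ n) (T x)
  T-scale ζ (α , γ) = cong₂ _,_
    (trans (cong (δ₁ *_) (^-distribʳ-* ζ γ n)) (solve 3 (λ d z g → d :* (z :* g) := z :* (d :* g)) refl δ₁ (ζ ^ n) (γ ^ n)))
    (trans (cong (δ₂ * (ζ * α) *_) (^-distribʳ-* ζ γ (suc m)))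
           (solve 5 (λ d z a zᵐ gᵐ → d :* (z :* a) :* (zᵐ :* gᵐ) := (z :* zᵐ) :* (d :* a :* gᵐ)) refl δ₂ ζ α (ζ ^ suc m) (γ ^ suc m)))

  ^-^ℕ-suc : ∀ ζ i → (ζ ^ (n ^ℕ i)) ^ n ≡ ζ ^ (n ^ℕ suc i)
  ^-^ℕ-suc ζ i = trans (^-*-assoc ζ (n ^ℕ i) n) (cong (ζ ^_) (ℕ.*-comm (n ^ℕ i) n))

  iter-T-scale : ∀ i ζ x → iter T i (scale ζ x) ≡ scale (ζ ^ (n ^ℕ i)) (iter T i x)
  iter-T-scale zero    ζ x = cong (λ t → scale t x) (sym (*-identityʳ ζ))
  iter-T-scale (suc i) ζ x = begin
    T (iter T i (scale ζ x))                        ≡⟨ cong T (iter-T-scale i ζ x) ⟩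
    T (scale (ζ ^ (n ^ℕ i)) (iter T i x))           ≡⟨ T-scale _ _ ⟩
    scale ((ζ ^ (n ^ℕ i)) ^ n) (iter T (suc i) x)   ≡⟨ cong (λ t → scale t (iter T (suc i) x)) (^-^ℕ-suc ζ i) ⟩
    scale (ζ ^ (n ^ℕ suc i)) (iter T (suc i) x)     ∎

  ψ-scale : ∀ ζ x → ψ (scale ζ x) ≡ ζ ^ suc n * ψ x
  ψ-scale ζ (α , γ) = trans (cong (ζ * α *_) (^-distribʳ-* ζ γ n))
    (solve 4 (λ z a zⁿ gⁿ → z :* a :* (zⁿ :* gⁿ) := (z :* zⁿ) :* (a :* gⁿ)) refl ζ α (ζ ^ n) (γ ^ n))

  iter-h-scale : ∀ i ζ P → iter h i (ζ * P) ≡ ζ ^ (n ^ℕ i) * iter h i P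
  iter-h-scale zero    ζ P = cong (_* P) (sym (*-identityʳ ζ))
  iter-h-scale (suc i) ζ P = begin
    κ * (iter h i (ζ * P)) ^ n                      ≡⟨ cong (λ t → κ * t ^ n) (iter-h-scale i ζ P) ⟩
    κ * (ζ ^ (n ^ℕ i) * iter h i P) ^ n             ≡⟨ cong (κ *_) (^-distribʳ-* _ _ n) ⟩
    κ * ((ζ ^ (n ^ℕ i)) ^ n * (iter h i P) ^ n)     ≡⟨ solve 3 (λ k a b → k :* (a :* b) := a :* (k :* b)) refl κ _ _ ⟩
    (ζ ^ (n ^ℕ i)) ^ n * iter h (suc i) P           ≡⟨ cong (_* iter h (suc i) P) (^-^ℕ-suc ζ i) ⟩
    ζ ^ (n ^ℕ suc i) * iter h (suc i) P             ∎

  SameRatio : Carrier × Carrier → Carrier × Carrier → Set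
  SameRatio (α , γ) (α′ , γ′) = α′ * γ ≡ γ′ * α

  SameRatio-T² : ∀ x → SameRatio x (T (T x))
  SameRatio-T² (α , γ) = solve 6 (λ d₁ d₂ a g G C → d₁ :* ((d₂ :* a :* G) :* C) :* g := d₂ :* (d₁ :* (g :* G)) :* C :* a)
    refl δ₁ δ₂ α γ (γ ^ suc m) ((δ₂ * α * γ ^ suc m) ^ suc m)

  SameRatio-trans : ∀ {x y z} → Invertible y → SameRatio x y → SameRatio y z → SameRatio x z
  SameRatio-trans {α₀ , γ₀} {α₁ , γ₁} {α₂ , γ₂} (α₁≢0 , γ₁≢0) xy yz = *-cancelʳ (*-≢0 α₁≢0 γ₁≢0) (begin
    α₂ * γ₀ * (α₁ * γ₁)   ≡⟨ swap α₂ γ₀ α₁ γ₁ ⟩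
    (α₂ * γ₁) * (α₁ * γ₀) ≡⟨ cong₂ _*_ yz xy ⟩
    (γ₂ * α₁) * (γ₁ * α₀) ≡⟨ swap γ₂ α₁ γ₁ α₀ ⟩
    γ₂ * α₀ * (γ₁ * α₁)   ≡⟨ cong (γ₂ * α₀ *_) (*-comm γ₁ α₁) ⟩
    γ₂ * α₀ * (α₁ * γ₁)   ∎)
    where
    swap : ∀ a b c d → a * b * (c * d) ≡ (a * d) * (c * b)
    swap = solve 4 (λ a b c d → a :* b :* (c :* d) := (a :* d) :* (c :* b)) refl

  SameRatio-iter-T² : ∀ i {x} → Invertible x → SameRatio x (iter (iter T 2) i x)
  SameRatio-iter-T² zero    {α , γ} _     = *-comm α γ
  SameRatio-iter-T² (suc i) {x}     inv-x =
    SameRatio-trans (subst Invertible (iter-* T i 2 x) (iter-T-Invertible (i ℕ.* 2) inv-x))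
                    (SameRatio-iter-T² i inv-x) (SameRatio-T² _)

  SameRatio⇒scale : ∀ {x y} → proj₂ x ≢ 0# → SameRatio x y → Σ Carrier (λ ζ → y ≡ scale ζ x)
  SameRatio⇒scale {α , γ} {α′ , γ′} γ≢0 α′γ≡γ′α = ζ , cong₂ _,_ α′≡ζα γ′≡ζγ
    where
    ζ = γ′ * inv γ γ≢0
    γ′≡ζγ : γ′ ≡ ζ * γ
    γ′≡ζγ = sym (trans (*-assoc _ _ _) (trans (cong (γ′ *_) (inverseˡ γ γ≢0)) (*-identityʳ γ′)))
    α′≡ζα : α′ ≡ ζ * α
    α′≡ζα = *-cancelʳ γ≢0 (trans α′γ≡γ′α (trans (cong (_* α) γ′≡ζγ) (solve 3 (λ z g a → z :* g :* a := z :* a :* g) refl ζ γ α)))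

  ^[n^2t]-fixed : ∀ {ζ} → ζ ^ suc n ≡ 1# → ∀ t → ζ ^ (n ^ℕ (t ℕ.* 2)) ≡ ζ
  ^[n^2t]-fixed {ζ} ζⁿ⁺¹≡1 zero    = *-identityʳ ζ
  ^[n^2t]-fixed {ζ} ζⁿ⁺¹≡1 (suc t) = begin
    ζ ^ (n ℕ.* (n ℕ.* X))  ≡⟨ cong (ζ ^_) (ℕ.*-assoc n n X) ⟨
    ζ ^ (n ℕ.* n ℕ.* X)    ≡⟨ ^-*-assoc ζ (n ℕ.* n) X ⟨
    (ζ ^ (n ℕ.* n)) ^ X    ≡⟨ cong (_^ X) ζ^n²≡ζ ⟩
    ζ ^ X                  ≡⟨ ^[n^2t]-fixed ζⁿ⁺¹≡1 t ⟩
    ζ                      ∎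
    where
    X : ℕ
    X = n ^ℕ (t ℕ.* 2)
    n²≡1+[n+1][n-1] : ∀ m → suc (suc m) ℕ.* suc (suc m) ≡ suc (suc (suc (suc m)) ℕ.* suc m)
    n²≡1+[n+1][n-1] = solve-∀
    ζ^n²≡ζ : ζ ^ (n ℕ.* n) ≡ ζ
    ζ^n²≡ζ = begin
      ζ ^ (n ℕ.* n)                   ≡⟨ cong (ζ ^_) (n²≡1+[n+1][n-1] m) ⟩
      ζ * ζ ^ (suc n ℕ.* suc m)       ≡⟨ cong (ζ *_) (^-*-assoc ζ (suc n) (suc m)) ⟨
      ζ * (ζ ^ suc n) ^ suc m         ≡⟨ cong (λ t → ζ * t ^ suc m) ζⁿ⁺¹≡1 ⟩
      ζ * 1# ^ suc m                  ≡⟨ cong (ζ *_) (1^m≡1 (suc m)) ⟩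
      ζ * 1#                          ≡⟨ *-identityʳ ζ ⟩
      ζ                               ∎

  -- With L the h-period of ψ x, T^(2L) x = ζ x since T² preserves α/γ, and ζ^(n+1) = 1 since ψ is fixed.
  -- Then ζ^(n²) = ζ, so T^(2L) multiplies every ζᵗ x by ζ and x returns after n+1 rounds.
  Periodic-ψ⇒Periodic : ∀ {x} → Invertible x → Periodic h (ψ x) → Periodic T x
  Periodic-ψ⇒Periodic {x} inv-x (l , hᴸψx≡ψx) = suc (l ℕ.* 2) ℕ.+ n ℕ.* L2 , (begin
    iter T (suc n ℕ.* L2) x   ≡⟨ iter-* T (suc n) L2 x ⟩
    iter H (suc n) x          ≡⟨ iter-H (suc n) ⟩
    scale (ζ ^ suc n) x       ≡⟨ cong (λ t → scale t x) ζⁿ⁺¹≡1 ⟩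
    scale 1# x                ≡⟨ scale-1 x ⟩
    x                         ∎)
    where
    L : ℕ
    L = suc l
    L2 : ℕ
    L2 = L ℕ.* 2
    H : Carrier × Carrier → Carrier × Carrier
    H = iter T L2
    ratio : Σ Carrier (λ ζ → H x ≡ scale ζ x)
    ratio = SameRatio⇒scale (proj₂ inv-x) (subst (SameRatio x) (sym (iter-* T L 2 x)) (SameRatio-iter-T² L inv-x))
    ζ : Carrier
    ζ = proj₁ ratio
    ψHx≡ψx : ψ (H x) ≡ ψ x
    ψHx≡ψx = trans (iter-ψ L2 x) (trans (cong (λ t → iter h t (ψ x)) (ℕ.*-comm L 2)) (iter-period h L hᴸψx≡ψx 2))
    ζⁿ⁺¹≡1 : ζ ^ suc n ≡ 1#
    ζⁿ⁺¹≡1 = *-cancelʳ (ψ-Invertible inv-x) (begin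
      ζ ^ suc n * ψ x   ≡⟨ ψ-scale ζ x ⟨
      ψ (scale ζ x)     ≡⟨ cong ψ (proj₂ ratio) ⟨
      ψ (H x)           ≡⟨ ψHx≡ψx ⟩
      ψ x               ≡⟨ *-identityˡ _ ⟨
      1# * ψ x          ∎)
    iter-H : ∀ t → iter H t x ≡ scale (ζ ^ t) x
    iter-H zero    = sym (scale-1 x)
    iter-H (suc t) = begin
      H (iter H t x)                          ≡⟨ cong H (iter-H t) ⟩
      H (scale (ζ ^ t) x)                     ≡⟨ iter-T-scale L2 (ζ ^ t) x ⟩
      scale ((ζ ^ t) ^ (n ^ℕ L2)) (H x)        ≡⟨ cong₂ scale (^[n^2t]-fixed ζᵗ-root L) (proj₂ ratio) ⟩
      scale (ζ ^ t) (scale ζ x)               ≡⟨ scale-scale _ _ x ⟩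
      scale (ζ ^ t * ζ) x                     ≡⟨ cong (λ u → scale u x) (*-comm _ _) ⟩
      scale (ζ ^ suc t) x                     ∎
      where
      ζᵗ-root : (ζ ^ t) ^ suc n ≡ 1#
      ζᵗ-root = trans (^-comm ζ t (suc n)) (trans (cong (_^ t) ζⁿ⁺¹≡1) (1^m≡1 t))

  periodic-twist≡1 : ∀ {ε Y} → Y ≢ 0# → ε ^ n ≡ 1# → Periodic h Y → Periodic h (ε * Y) → ε ≡ 1#
  periodic-twist≡1 {ε} {Y} Y≢0 εⁿ≡1 (a , hᵃ⁺¹Y≡Y) (b , hᵇ⁺¹εY≡εY) = *-cancelʳ Y≢0 (begin
    ε * Y                          ≡⟨ iter-period h (suc b) hᵇ⁺¹εY≡εY (suc a) ⟨
    iter h M (ε * Y)               ≡⟨ iter-h-scale M ε Y ⟩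
    ε ^ (n ^ℕ M) * iter h M Y      ≡⟨ cong₂ _*_ ε^nᴹ≡1 hᴹY≡Y ⟩
    1# * Y                         ∎)
    where
    M : ℕ
    M = suc a ℕ.* suc b
    hᴹY≡Y : iter h M Y ≡ Y
    hᴹY≡Y = trans (cong (λ t → iter h t Y) (ℕ.*-comm (suc a) (suc b))) (iter-period h (suc a) hᵃ⁺¹Y≡Y (suc b))
    ε^nᴹ≡1 : ε ^ (n ^ℕ M) ≡ 1#
    ε^nᴹ≡1 = trans (sym (^-*-assoc ε n (n ^ℕ M′))) (trans (cong (_^ (n ^ℕ M′)) εⁿ≡1) (1^m≡1 (n ^ℕ M′)))
      where
        M′ : ℕ
        M′ = b ℕ.+ a ℕ.* suc b

  iter-h : ∀ t P → iter h t P ≡ κ ^ repunit n t * P ^ (n ^ℕ t)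
  iter-h zero    P = trans (sym (*-identityʳ P)) (sym (*-identityˡ _))
  iter-h (suc t) P = begin
    κ * (iter h t P) ^ n                                ≡⟨ cong (λ u → κ * u ^ n) (iter-h t P) ⟩
    κ * (κ ^ repunit n t * P ^ (n ^ℕ t)) ^ n            ≡⟨ cong (κ *_) (^-distribʳ-* _ _ n) ⟩
    κ * ((κ ^ repunit n t) ^ n * (P ^ (n ^ℕ t)) ^ n)
      ≡⟨ cong₂ (λ u v → κ * (u * v)) (trans (^-*-assoc κ (repunit n t) n) (cong (κ ^_) (ℕ.*-comm (repunit n t) n))) (^-^ℕ-suc P t) ⟩
    κ * (κ ^ (n ℕ.* repunit n t) * P ^ (n ^ℕ suc t))    ≡⟨ *-assoc _ _ _ ⟨
    κ ^ repunit n (suc t) * P ^ (n ^ℕ suc t)            ∎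

  iter-h-eventually-periodic : ∀ {N P} E J → N ∣ n ^ℕ E ℕ.* repunit n J → κ ^ N ≡ 1# → P ^ N ≡ 1# →
                               iter h (J ℕ.+ E) P ≡ iter h E P
  iter-h-eventually-periodic {N} {P} E J (divides t nᴱR≡tN) κᴺ≡1 Pᴺ≡1 = begin
    iter h (J ℕ.+ E) P                                  ≡⟨ cong (λ i → iter h i P) (ℕ.+-comm J E) ⟩
    iter h (E ℕ.+ J) P                                  ≡⟨ iter-h (E ℕ.+ J) P ⟩
    κ ^ repunit n (E ℕ.+ J) * P ^ (n ^ℕ (E ℕ.+ J))      ≡⟨ cong₂ (λ u v → κ ^ u * P ^ v) (repunit-+ n E J) (ℕ.^-distribˡ-+-* n E J) ⟩
    κ ^ (repunit n E ℕ.+ X) * P ^ (nᴱ ℕ.* n ^ℕ J)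
      ≡⟨ cong₂ _*_ (^-distribˡ-+-* κ (repunit n E) X) (cong (λ v → P ^ (nᴱ ℕ.* v)) ([1+m]^t≡1+repunit*m (suc m) J)) ⟩
    κ ^ repunit n E * κ ^ X * P ^ (nᴱ ℕ.* suc (R ℕ.* suc m))  ≡⟨ cong₂ (λ u v → κ ^ repunit n E * u * P ^ v) (to-one κᴺ≡1) P-exponent ⟩
    κ ^ repunit n E * 1# * P ^ (nᴱ ℕ.+ X ℕ.* suc m)
      ≡⟨ cong₂ _*_ (*-identityʳ _) (trans (^-distribˡ-+-* P nᴱ _) (cong (P ^ nᴱ *_) P^[X*m]≡1)) ⟩
    κ ^ repunit n E * (P ^ nᴱ * 1#)                     ≡⟨ cong (κ ^ repunit n E *_) (*-identityʳ _) ⟩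
    κ ^ repunit n E * P ^ nᴱ                            ≡⟨ iter-h E P ⟨
    iter h E P                                          ∎
    where
    nᴱ : ℕ
    nᴱ = n ^ℕ E
    R : ℕ
    R = repunit n J
    X : ℕ
    X = nᴱ ℕ.* R
    to-one : ∀ {u} → u ^ N ≡ 1# → u ^ X ≡ 1#
    to-one {u} uᴺ≡1 = trans (cong (u ^_) (trans nᴱR≡tN (ℕ.*-comm t N))) (^≡1⇒^*≡1 N uᴺ≡1 t)
    P-exponent : nᴱ ℕ.* suc (R ℕ.* suc m) ≡ nᴱ ℕ.+ X ℕ.* suc m
    P-exponent = trans (ℕ.*-suc nᴱ _) (cong (nᴱ ℕ.+_) (sym (ℕ.*-assoc nᴱ R (suc m))))
    P^[X*m]≡1 : P ^ (X ℕ.* suc m) ≡ 1#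
    P^[X*m]≡1 = trans (sym (^-*-assoc P X (suc m))) (trans (cong (_^ suc m) (to-one Pᴺ≡1)) (1^m≡1 (suc m)))

  ψ-scale-root : ∀ {ζ} x → ζ ^ n ≡ 1# → ψ (scale ζ x) ≡ ζ * ψ x
  ψ-scale-root {ζ} x ζⁿ≡1 = trans (ψ-scale ζ x) (cong (_* ψ x) (trans (cong (ζ *_) ζⁿ≡1) (*-identityʳ ζ)))

module QuadraticExtension (F : FiniteField) {p : ℕ} (p-prime : Prime p) (p≢2 : p ≢ 2)
                          (k q : ℕ) (q≡pᵏ⁺¹ : q ≡ p ^ℕ suc k) (size≡q² : FiniteField.size F ≡ q ℕ.* q) where
  open FieldProperties F
  open FieldCounting F using (characteristic; fermat)
  open Frobenius F using (frobenius-^)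
  open ≡-Reasoning

  p^j·1≡[p·1]^j : ∀ j → (p ^ℕ j) · 1# ≡ (p · 1#) ^ j
  p^j·1≡[p·1]^j zero    = +-identityʳ 1#
  p^j·1≡[p·1]^j (suc j) = trans (×1-homo-* p (p ^ℕ j)) (cong ((p · 1#) *_) (p^j·1≡[p·1]^j j))

  characteristic-p : p · 1# ≡ 0#
  characteristic-p = ^≡0⇒≡0 (suc k ℕ.+ suc k) (begin
    (p · 1#) ^ (suc k ℕ.+ suc k)        ≡⟨ p^j·1≡[p·1]^j (suc k ℕ.+ suc k) ⟨
    (p ^ℕ (suc k ℕ.+ suc k)) · 1#       ≡⟨ cong (_· 1#) (ℕ.^-distribˡ-+-* p (suc k) (suc k)) ⟩
    (p ^ℕ suc k ℕ.* p ^ℕ suc k) · 1#    ≡⟨ cong (λ t → (t ℕ.* t) · 1#) q≡pᵏ⁺¹ ⟨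
    (q ℕ.* q) · 1#                      ≡⟨ cong (_· 1#) size≡q² ⟨
    size · 1#                           ≡⟨ characteristic ⟩
    0#                                  ∎)

  2≤q : 2 ≤ q
  2≤q = subst (2 ≤_) (sym q≡pᵏ⁺¹) (ℕ.≤-trans (prime⇒≥2 p-prime) (ℕ.m≤m*n p (p ^ℕ k) {{ℕ.m^n≢0 p k {{prime⇒nonZero p-prime}}}}))

  q≡2+[q∸2] : q ≡ suc (suc (q ∸ 2))
  q≡2+[q∸2] = sym (ℕ.m+[n∸m]≡n 2≤q)

  q≡1+[q∸1] : q ≡ suc (q ∸ 1)
  q≡1+[q∸1] = sym (ℕ.m+[n∸m]≡n (ℕ.<⇒≤ 2≤q))

  q∸1≢0 : q ∸ 1 ≢ 0
  q∸1≢0 q∸1≡0 = contradiction (trans (sym (cong (_∸ 1) q≡2+[q∸2])) q∸1≡0) λ ()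

  frobenius-q : ∀ x y → (x + y) ^ q ≡ x ^ q + y ^ q
  frobenius-q x y = subst (λ t → (x + y) ^ t ≡ x ^ t + y ^ t) (sym q≡pᵏ⁺¹) (frobenius-^ characteristic-p p-prime (suc k) x y)

  0^q≡0 : 0# ^ q ≡ 0#
  0^q≡0 = subst (λ t → 0# ^ t ≡ 0#) (sym q≡2+[q∸2]) (zeroˡ _)

  -‿^q : ∀ x → (- x) ^ q ≡ - (x ^ q)
  -‿^q x = +-inverseʳ-unique (x ^ q) ((- x) ^ q) (begin
    x ^ q + (- x) ^ q  ≡⟨ frobenius-q x (- x) ⟨
    (x - x) ^ q        ≡⟨ cong (_^ q) (-‿inverseʳ x) ⟩
    0# ^ q             ≡⟨ 0^q≡0 ⟩
    0#                 ∎)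

  ^q-involutive : ∀ x → (x ^ q) ^ q ≡ x
  ^q-involutive x = trans (^-*-assoc x q q) (trans (cong (x ^_) (sym size≡q²)) (fermat x))

  InFq : Carrier → Set
  InFq x = x ^ q ≡ x

  1∈Fq : InFq 1#
  1∈Fq = 1^m≡1 q

  +-InFq : ∀ {x y} → InFq x → InFq y → InFq (x + y)
  +-InFq x∈ y∈ = trans (frobenius-q _ _) (cong₂ _+_ x∈ y∈)

  -‿InFq : ∀ {x} → InFq x → InFq (- x)
  -‿InFq x∈ = trans (-‿^q _) (cong -_ x∈)

  *-InFq : ∀ {x y} → InFq x → InFq y → InFq (x * y)
  *-InFq x∈ y∈ = trans (^-distribʳ-* _ _ q) (cong₂ _*_ x∈ y∈)

  ^-InFq : ∀ {x} m → InFq x → InFq (x ^ m)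
  ^-InFq {x} m x∈ = trans (^-comm x m q) (cong (_^ m) x∈)

  inv-InFq : ∀ {x} (x≢0 : x ≢ 0#) → InFq x → InFq (inv x x≢0)
  inv-InFq {x} x≢0 x∈ = *-cancelʳ x≢0 (begin
    inv x x≢0 ^ q * x        ≡⟨ cong (inv x x≢0 ^ q *_) x∈ ⟨
    inv x x≢0 ^ q * x ^ q    ≡⟨ ^-distribʳ-* _ _ q ⟨
    (inv x x≢0 * x) ^ q      ≡⟨ cong (_^ q) (inverseˡ x x≢0) ⟩
    1# ^ q                   ≡⟨ 1^m≡1 q ⟩
    1#                       ≡⟨ inverseˡ x x≢0 ⟨
    inv x x≢0 * x            ∎)

  ^[q∸1]-InFq : ∀ {x} → InFq x → x ≢ 0# → x ^ (q ∸ 1) ≡ 1#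
  ^[q∸1]-InFq {x} x∈ x≢0 = *-cancelˡ x≢0 (trans (trans (cong (x ^_) (sym q≡1+[q∸1])) x∈) (sym (*-identityʳ x)))

  2≢0 : 1# + 1# ≢ 0#
  2≢0 1+1≡0 with odd-prime p-prime p≢2
  ... | m , p≡1+2m = 1≢0 (begin
    1#                               ≡⟨ +-identityʳ 1# ⟨
    1# + 0#                          ≡⟨ cong (1# +_) (zeroʳ (m · 1#)) ⟨
    1# + (m · 1#) * 0#               ≡⟨ cong (λ t → 1# + (m · 1#) * t) (trans (cong (1# +_) (+-identityʳ 1#)) 1+1≡0) ⟨
    1# + (m · 1#) * (2 · 1#)         ≡⟨ cong (1# +_) (×1-homo-* m 2) ⟨
    suc (m ℕ.* 2) · 1#               ≡⟨ cong (_· 1#) p≡1+2m ⟨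
    p · 1#                           ≡⟨ characteristic-p ⟩
    0#                               ∎)

  norm : Carrier → Carrier
  norm y = y * y ^ q

  norm-InFq : ∀ y → InFq (norm y)
  norm-InFq y = trans (^-distribʳ-* y (y ^ q) q) (trans (cong (y ^ q *_) (^q-involutive y)) (*-comm _ _))

  -- The root bound gives y with y^((q+1)X+1) ≢ y; its norm y^(q+1) lies in 𝔽_q and is not an X-th root of 1.
  ∃w^X≢1 : ∀ X → 1 ≤ X → X < q ∸ 1 → Σ Carrier (λ w → InFq w × w ≢ 0# × w ^ X ≢ 1#)
  ∃w^X≢1 X 1≤X X<q-1 = norm y , norm-InFq y , *-≢0 y≢0 (^-≢0 q y≢0) , wˣ≢1
    where
    D : ℕ
    D = suc q ℕ.* X
    2≤1+D : 2 ≤ suc D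
    2≤1+D = s≤s (ℕ.≤-trans 1≤X (ℕ.m≤n*m X (suc q)))
    2+D≤size : suc (suc D) ≤ size
    2+D≤size = subst₂ (λ u v → suc (suc (suc u ℕ.* X)) ≤ v) (sym q≡2+[q∸2]) (trans (cong (λ t → t ℕ.* t) (sym q≡2+[q∸2])) (sym size≡q²))
                 ([q+1]X+2≤q² (q ∸ 2) X (ℕ.≤-pred (subst (X <_) (cong (_∸ 1) q≡2+[q∸2]) X<q-1)))
    non-fixed : Σ Carrier (λ y → y ^ suc D ≢ y)
    non-fixed = Polynomials.∃y^m≢y F (suc D) 2≤1+D 2+D≤size
    y : Carrier
    y = proj₁ non-fixed
    y≢0 : y ≢ 0#
    y≢0 y≡0 = proj₂ non-fixed (trans (cong (_^ suc D) y≡0) (trans (zeroˡ _) (sym y≡0)))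
    wˣ≢1 : norm y ^ X ≢ 1#
    wˣ≢1 wˣ≡1 = proj₂ non-fixed (begin
      y * y ^ D          ≡⟨ cong (y *_) (^-*-assoc y (suc q) X) ⟨
      y * norm y ^ X     ≡⟨ cong (y *_) wˣ≡1 ⟩
      y * 1#             ≡⟨ *-identityʳ y ⟩
      y                  ∎)

  ^r-n^[1+e]≡1∧n^e≢1 : ∀ {n s r e w} → q ∸ 1 ≡ s ℕ.* r → s ∣ n ^ℕ suc e → InFq w → w ≢ 0# → w ^ (gcd (n ^ℕ e) (q ∸ 1) ℕ.* r) ≢ 1# →
              (w ^ r) ^ (n ^ℕ suc e) ≡ 1# × (w ^ r) ^ (n ^ℕ e) ≢ 1#
  ^r-n^[1+e]≡1∧n^e≢1 {n} {s} {r} {e} {w} q-1≡sr (divides t nᵉ⁺¹≡ts) w∈ w≢0 wᵍʳ≢1 = ηⁿᵉ⁺¹≡1 , ηⁿᵉ≢1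
    where
    N : ℕ
    N = q ∸ 1
    ηⁿᵉ⁺¹≡1 : (w ^ r) ^ (n ^ℕ suc e) ≡ 1#
    ηⁿᵉ⁺¹≡1 = begin
      (w ^ r) ^ (n ^ℕ suc e)   ≡⟨ cong ((w ^ r) ^_) nᵉ⁺¹≡ts ⟩
      (w ^ r) ^ (t ℕ.* s)      ≡⟨ ^-*-assoc w r (t ℕ.* s) ⟩
      w ^ (r ℕ.* (t ℕ.* s))    ≡⟨ cong (w ^_) (rearrange r t s) ⟩
      w ^ ((s ℕ.* r) ℕ.* t)    ≡⟨ cong (λ u → w ^ (u ℕ.* t)) q-1≡sr ⟨
      w ^ (N ℕ.* t)            ≡⟨ ^≡1⇒^*≡1 N (^[q∸1]-InFq w∈ w≢0) t ⟩
      1#                       ∎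
      where
      rearrange : ∀ r t s → r ℕ.* (t ℕ.* s) ≡ (s ℕ.* r) ℕ.* t
      rearrange = solve-∀
    ηⁿᵉ≢1 : (w ^ r) ^ (n ^ℕ e) ≢ 1#
    ηⁿᵉ≢1 ηⁿᵉ≡1 = wᵍʳ≢1 (begin
      w ^ (gcd (n ^ℕ e) N ℕ.* r)    ≡⟨ cong (w ^_) (ℕ.*-comm (gcd (n ^ℕ e) N) r) ⟩
      w ^ (r ℕ.* gcd (n ^ℕ e) N)    ≡⟨ ^-*-assoc w r (gcd (n ^ℕ e) N) ⟨
      (w ^ r) ^ gcd (n ^ℕ e) N      ≡⟨ ^-gcd (n ^ℕ e) N ηⁿᵉ≡1 (^[q∸1]-InFq (^-InFq r w∈) (^-≢0 r w≢0)) ⟩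
      1#                            ∎)

  ∃η^nᵉ⁺¹≡1∧η^nᵉ≢1 : ∀ {n s r e} → q ∸ 1 ≡ s ℕ.* r → gcd (n ^ℕ e) (q ∸ 1) < s → s ∣ n ^ℕ suc e →
                     Σ Carrier (λ η → InFq η × η ^ (n ^ℕ suc e) ≡ 1# × η ^ (n ^ℕ e) ≢ 1#)
  ∃η^nᵉ⁺¹≡1∧η^nᵉ≢1 {n} {s} {r} {e} q-1≡sr g<s s∣nᵉ⁺¹ =
    let w , w∈ , w≢0 , wᵍʳ≢1 = ∃w^X≢1 (g ℕ.* r) 1≤gr gr<q-1
    in  w ^ r , ^-InFq r w∈ , ^r-n^[1+e]≡1∧n^e≢1 {n} {s} {r} {e} q-1≡sr s∣nᵉ⁺¹ w∈ w≢0 wᵍʳ≢1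
    where
    g : ℕ
    g = gcd (n ^ℕ e) (q ∸ 1)
    r≢0 : r ≢ 0
    r≢0 refl = q∸1≢0 (trans q-1≡sr (ℕ.*-zeroʳ s))
    g≢0 : g ≢ 0
    g≢0 = gcd[m,n]≢0 (n ^ℕ e) (q ∸ 1) (inj₂ q∸1≢0)
    1≤gr : 1 ≤ g ℕ.* r
    1≤gr = ℕ.>-nonZero⁻¹ (g ℕ.* r) {{ℕ.m*n≢0 g r {{ℕ.≢-nonZero g≢0}} {{ℕ.≢-nonZero r≢0}}}}
    gr<q-1 : g ℕ.* r < q ∸ 1
    gr<q-1 = subst (g ℕ.* r <_) (sym q-1≡sr) (ℕ.*-monoˡ-< r {{ℕ.≢-nonZero r≢0}} g<s)

  module Coordinates (β : Carrier) (β^q≢β : β ^ q ≢ β) (β²∈Fq : InFq (β * β)) where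

    β≢0 : β ≢ 0#
    β≢0 β≡0 = β^q≢β (trans (cong (_^ q) β≡0) (trans 0^q≡0 (sym β≡0)))

    β^q≡-β : β ^ q ≡ - β
    β^q≡-β with x*y≡0⇒x≡0⊎y≡0 [β^q-β][β^q+β]≡0
      where
      [β^q-β][β^q+β]≡0 : (β ^ q - β) * (β ^ q + β) ≡ 0#
      [β^q-β][β^q+β]≡0 = begin
        (β ^ q - β) * (β ^ q + β)    ≡⟨ solve 2 (λ u b → (u :- b) :* (u :+ b) := u :* u :- b :* b) refl (β ^ q) β ⟩
        β ^ q * β ^ q - β * β        ≡⟨ cong (_- β * β) (^-distribʳ-* β β q) ⟨
        (β * β) ^ q - β * β          ≡⟨ cong (_- β * β) β²∈Fq ⟩
        β * β - β * β                ≡⟨ -‿inverseʳ _ ⟩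
        0#                           ∎
    ... | inj₁ β^q-β≡0 = contradiction (x-y≡0⇒x≡y _ _ β^q-β≡0) β^q≢β
    ... | inj₂ β^q+β≡0 = +-inverseʳ-unique β (β ^ q) (trans (+-comm β _) β^q+β≡0)

    β^even-InFq : ∀ {m} → 2 ∣ m → InFq (β ^ m)
    β^even-InFq (divides t refl) = subst InFq (trans (^-*-assoc β 2 t) (cong (β ^_) (ℕ.*-comm 2 t)))
                                          (^-InFq t (subst InFq (cong (β *_) (sym (*-identityʳ β))) β²∈Fq))

    E : Carrier × Carrier → Carrier
    E (α , γ) = α + γ * β

    InFq² : Carrier × Carrier → Set
    InFq² (α , γ) = InFq α × InFq γ

    E-^q : ∀ {α γ} → InFq² (α , γ) → E (α , γ) ^ q ≡ α - γ * β
    E-^q {α} {γ} (α∈ , γ∈) = begin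
      (α + γ * β) ^ q        ≡⟨ frobenius-q α (γ * β) ⟩
      α ^ q + (γ * β) ^ q    ≡⟨ cong₂ _+_ α∈ (^-distribʳ-* γ β q) ⟩
      α + γ ^ q * β ^ q      ≡⟨ cong₂ (λ u v → α + u * v) γ∈ β^q≡-β ⟩
      α + γ * - β            ≡⟨ cong (α +_) (-‿distribʳ-* γ β) ⟨
      α - γ * β              ∎

    E-injective : ∀ {u v} → InFq² u → InFq² v → E u ≡ E v → u ≡ v
    E-injective {α , γ} {α′ , γ′} u∈ v∈ Eu≡Ev = cong₂ _,_ α≡α′ γ≡γ′
      where
      Eu^q≡Ev^q : α - γ * β ≡ α′ - γ′ * β
      Eu^q≡Ev^q = trans (sym (E-^q u∈)) (trans (cong (_^ q) Eu≡Ev) (E-^q v∈))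
      α≡α′ : α ≡ α′
      α≡α′ = *-cancelˡ 2≢0 (begin
        (1# + 1#) * α
          ≡⟨ solve 3 (λ α γ β → (con (ℤ.+ 1) :+ con (ℤ.+ 1)) :* α := (α :+ γ :* β) :+ (α :- γ :* β)) refl α γ β ⟩
        (α + γ * β) + (α - γ * β)         ≡⟨ cong₂ _+_ Eu≡Ev Eu^q≡Ev^q ⟩
        (α′ + γ′ * β) + (α′ - γ′ * β)
          ≡⟨ solve 3 (λ α γ β → (α :+ γ :* β) :+ (α :- γ :* β) := (con (ℤ.+ 1) :+ con (ℤ.+ 1)) :* α) refl α′ γ′ β ⟩
        (1# + 1#) * α′                    ∎)
      γ≡γ′ : γ ≡ γ′
      γ≡γ′ = *-cancelʳ β≢0 (begin
        γ * β                  ≡⟨ solve 3 (λ α γ β → γ :* β := (:- α) :+ (α :+ γ :* β)) refl α γ β ⟩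
        - α + (α + γ * β)      ≡⟨ cong₂ (λ u v → - u + v) α≡α′ Eu≡Ev ⟩
        - α′ + (α′ + γ′ * β)   ≡⟨ solve 3 (λ α γ β → (:- α) :+ (α :+ γ :* β) := γ :* β) refl α′ γ′ β ⟩
        γ′ * β                 ∎)

    ½ : Carrier
    ½ = inv (1# + 1#) 2≢0

    β⁻¹ : Carrier
    β⁻¹ = inv β β≢0

    β⁻¹^q≡-β⁻¹ : β⁻¹ ^ q ≡ - β⁻¹
    β⁻¹^q≡-β⁻¹ = *-cancelʳ β≢0 (begin
      β⁻¹ ^ q * β            ≡⟨ solve 2 (λ u b → u :* b := :- (u :* (:- b))) refl (β⁻¹ ^ q) β ⟩
      - (β⁻¹ ^ q * - β)      ≡⟨ cong (λ t → - (β⁻¹ ^ q * t)) β^q≡-β ⟨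
      - (β⁻¹ ^ q * β ^ q)    ≡⟨ cong -_ (^-distribʳ-* β⁻¹ β q) ⟨
      - ((β⁻¹ * β) ^ q)      ≡⟨ cong (λ t → - (t ^ q)) (inverseˡ β β≢0) ⟩
      - (1# ^ q)             ≡⟨ cong -_ (1^m≡1 q) ⟩
      - 1#                   ≡⟨ cong -_ (inverseˡ β β≢0) ⟨
      - (β⁻¹ * β)            ≡⟨ -‿distribˡ-* β⁻¹ β ⟩
      - β⁻¹ * β              ∎)

    coords : Carrier → Carrier × Carrier
    coords x = (x + x ^ q) * ½ , (x - x ^ q) * (½ * β⁻¹)

    coords-InFq² : ∀ x → InFq² (coords x)
    coords-InFq² x = re∈ , im∈
      where
      ½∈ : InFq ½
      ½∈ = inv-InFq 2≢0 (+-InFq 1∈Fq 1∈Fq)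
      re∈ : InFq ((x + x ^ q) * ½)
      re∈ = begin
        ((x + x ^ q) * ½) ^ q         ≡⟨ ^-distribʳ-* _ _ q ⟩
        (x + x ^ q) ^ q * ½ ^ q       ≡⟨ cong₂ _*_ (frobenius-q _ _) ½∈ ⟩
        (x ^ q + (x ^ q) ^ q) * ½     ≡⟨ cong (λ t → (x ^ q + t) * ½) (^q-involutive x) ⟩
        (x ^ q + x) * ½               ≡⟨ cong (_* ½) (+-comm _ _) ⟩
        (x + x ^ q) * ½               ∎
      im∈ : InFq ((x - x ^ q) * (½ * β⁻¹))
      im∈ = begin
        ((x - x ^ q) * (½ * β⁻¹)) ^ q             ≡⟨ ^-distribʳ-* _ _ q ⟩
        (x - x ^ q) ^ q * (½ * β⁻¹) ^ q           ≡⟨ cong₂ _*_ (trans (frobenius-q _ _) (cong (x ^ q +_) (-‿^q _))) (^-distribʳ-* _ _ q) ⟩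
        (x ^ q - (x ^ q) ^ q) * (½ ^ q * β⁻¹ ^ q) ≡⟨ cong₂ (λ u v → (x ^ q - u) * v) (^q-involutive x) (cong₂ _*_ ½∈ β⁻¹^q≡-β⁻¹) ⟩
        (x ^ q - x) * (½ * - β⁻¹)
          ≡⟨ solve 4 (λ x y a b → (y :- x) :* (a :* (:- b)) := (x :- y) :* (a :* b)) refl x (x ^ q) ½ β⁻¹ ⟩
        (x - x ^ q) * (½ * β⁻¹)                   ∎

    E-coords : ∀ x → E (coords x) ≡ x
    E-coords x = begin
      (x + x ^ q) * ½ + (x - x ^ q) * (½ * β⁻¹) * β          ≡⟨ solve 5 (λ x y a b c → (x :+ y) :* a :+ (x :- y) :* (a :* b) :* c
                                                                   := (a :* (con (ℤ.+ 1) :+ con (ℤ.+ 1))) :* x :+ ((x :- y) :* a) :* (b :* c :- con (ℤ.+ 1)))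
                                                                   refl x (x ^ q) ½ β⁻¹ β ⟩
      (½ * (1# + 1#)) * x + ((x - x ^ q) * ½) * (β⁻¹ * β - 1#)
        ≡⟨ cong₂ (λ u v → u * x + ((x - x ^ q) * ½) * (v - 1#)) (inverseˡ _ 2≢0) (inverseˡ β β≢0) ⟩
      1# * x + ((x - x ^ q) * ½) * (1# - 1#)
        ≡⟨ solve 3 (λ x y a → con (ℤ.+ 1) :* x :+ ((x :- y) :* a) :* (con (ℤ.+ 1) :- con (ℤ.+ 1)) := x) refl x (x ^ q) ½ ⟩
      x                                                        ∎

module Dynamics (F : FiniteField) where
  open FieldProperties F

  module _ {p : ℕ} (p-prime : Prime p) (p≢2 : p ≢ 2) (k q : ℕ) (q≡pᵏ⁺¹ : q ≡ p ^ℕ suc k) (size≡q² : size ≡ q ℕ.* q)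
           (β : Carrier) (β^q≢β : β ^ q ≢ β) (β²^q≡β² : (β * β) ^ q ≡ β * β)
           (a c : Carrier) (a^q≡a : a ^ q ≡ a) (c^q≡c : c ^ q ≡ c) (m : ℕ) (2∣m : 2 ∣ m) where
    open QuadraticExtension F p-prime p≢2 k q q≡pᵏ⁺¹ size≡q²
    open Coordinates β β^q≢β β²^q≡β²
    open ≡-Reasoning

    n : ℕ
    n = suc (suc m)

    f : Carrier → Carrier
    f x = (c * x ^ q + a * x) * (x ^ q - x) ^ (n ∸ 1)

    m2 : Carrier
    m2 = - (1# + 1#)

    δ₁ δ₂ : Carrier
    δ₁ = (a - c) * m2 ^ (n ∸ 1) * β ^ n
    δ₂ = (a + c) * m2 ^ (n ∸ 1) * β ^ (n ∸ 2)

    β^m-InFq : InFq (β ^ m)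
    β^m-InFq = β^even-InFq 2∣m

    m2-InFq : InFq m2
    m2-InFq = -‿InFq (+-InFq 1∈Fq 1∈Fq)

    δ₁-InFq : InFq δ₁
    δ₁-InFq = *-InFq (*-InFq (+-InFq a^q≡a (-‿InFq c^q≡c)) (^-InFq (suc m) m2-InFq))
                     (subst InFq (*-assoc β β (β ^ m)) (*-InFq β²^q≡β² β^m-InFq))

    δ₂-InFq : InFq δ₂
    δ₂-InFq = *-InFq (*-InFq (+-InFq a^q≡a c^q≡c) (^-InFq (suc m) m2-InFq)) β^m-InFq

    module _ (δ₁δ₂≢0 : δ₁ * δ₂ ≢ 0#) where

      δ₁≢0 : δ₁ ≢ 0#
      δ₁≢0 δ₁≡0 = δ₁δ₂≢0 (trans (cong (_* δ₂) δ₁≡0) (zeroˡ δ₂))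

      δ₂≢0 : δ₂ ≢ 0#
      δ₂≢0 δ₂≡0 = δ₁δ₂≢0 (trans (cong (δ₁ *_) δ₂≡0) (zeroʳ δ₁))

      open MonomialMap F m δ₁ δ₂ δ₁≢0 δ₂≢0 hiding (n)

      T-InFq² : ∀ {u} → InFq² u → InFq² (T u)
      T-InFq² (α∈ , γ∈) = *-InFq δ₁-InFq (^-InFq n γ∈) , *-InFq (*-InFq δ₂-InFq α∈) (^-InFq (suc m) γ∈)

      iter-T-InFq² : ∀ i {u} → InFq² u → InFq² (iter T i u)
      iter-T-InFq² zero    u∈ = u∈
      iter-T-InFq² (suc i) u∈ = T-InFq² (iter-T-InFq² i u∈)

      f-E : ∀ {u} → InFq² u → f (E u) ≡ E (T u)
      f-E {α , γ} u∈ = begin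
        (c * x ^ q + a * x) * (x ^ q - x) ^ suc m                ≡⟨ cong (λ t → (c * t + a * x) * (t - x) ^ suc m) (E-^q u∈) ⟩
        (c * x̄ + a * x) * (x̄ - x) ^ suc m                        ≡⟨ cong (λ t → (c * x̄ + a * x) * t ^ suc m) x̄-x≡m2γβ ⟩
        (c * x̄ + a * x) * (m2 * (γ * β)) ^ suc m
          ≡⟨ cong ((c * x̄ + a * x) *_) (trans (^-distribʳ-* m2 (γ * β) (suc m)) (cong (M *_) (^-distribʳ-* γ β (suc m)))) ⟩
        (c * x̄ + a * x) * (M * (G * (β * B)))
          ≡⟨ solve 8 (λ a c α γ β M G B → (c :* (α :- γ :* β) :+ a :* (α :+ γ :* β)) :* (M :* (G :* (β :* B)))
                                      := (a :- c) :* M :* (β :* (β :* B)) :* (γ :* G) :+ (a :+ c) :* M :* B :* α :* G :* β)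
                     refl a c α γ β M G B ⟩
        δ₁ * γ ^ n + δ₂ * α * γ ^ suc m * β                      ∎
        where
        x : Carrier
        x = α + γ * β
        x̄ : Carrier
        x̄ = α - γ * β
        M : Carrier
        M = m2 ^ suc m
        G : Carrier
        G = γ ^ suc m
        B : Carrier
        B = β ^ m
        x̄-x≡m2γβ : x̄ - x ≡ m2 * (γ * β)
        x̄-x≡m2γβ = solve 3 (λ α γ β → (α :- γ :* β) :- (α :+ γ :* β) := (:- (con (ℤ.+ 1) :+ con (ℤ.+ 1))) :* (γ :* β)) refl α γ β

      iter-f-E : ∀ i {u} → InFq² u → iter f i (E u) ≡ E (iter T i u)
      iter-f-E zero    u∈ = refl
      iter-f-E (suc i) u∈ = trans (cong f (iter-f-E i u∈)) (f-E (iter-T-InFq² i u∈))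

      Periodic-f⇒T : ∀ {u} → InFq² u → Periodic f (E u) → Periodic T u
      Periodic-f⇒T u∈ (k , fᵏ⁺¹Eu≡Eu) = k , E-injective (iter-T-InFq² (suc k) u∈) u∈ (trans (sym (iter-f-E (suc k) u∈)) fᵏ⁺¹Eu≡Eu)

      Periodic-T⇒f : ∀ {u} → InFq² u → Periodic T u → Periodic f (E u)
      Periodic-T⇒f u∈ (k , Tᵏ⁺¹u≡u) = k , trans (iter-f-E (suc k) u∈) (cong E Tᵏ⁺¹u≡u)

      E-0 : E (0# , 0#) ≡ 0#
      E-0 = trans (+-identityˡ _) (zeroˡ β)

      iter-f-Degenerate : ∀ {u} l → 2 ≤ l → InFq² u → Degenerate u → iter f l (E u) ≡ 0#
      iter-f-Degenerate {u} l 2≤l u∈ deg = begin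
        iter f l (E u)                 ≡⟨ iter-f-E l u∈ ⟩
        E (iter T l u)                 ≡⟨ cong (λ i → E (iter T i u)) (ℕ.m∸n+n≡m 2≤l) ⟨
        E (iter T (l ∸ 2 ℕ.+ 2) u)     ≡⟨ cong E (iter-T-Degenerate (l ∸ 2) u deg) ⟩
        E (0# , 0#)                    ≡⟨ E-0 ⟩
        0#                             ∎

      κ-InFq : InFq κ
      κ-InFq = *-InFq δ₁-InFq (^-InFq n δ₂-InFq)

      κ≢0 : κ ≢ 0#
      κ≢0 = *-≢0 δ₁≢0 (^-≢0 n δ₂≢0)

      ψ-InFq : ∀ {u} → InFq² u → InFq (ψ u)
      ψ-InFq (α∈ , γ∈) = *-InFq α∈ (^-InFq n γ∈)

      Periodic-nonzero⇒Invertible : ∀ {v} → InFq² v → E v ≢ 0# → Periodic f (E v) → Invertible v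
      Periodic-nonzero⇒Invertible {v} v∈ Ev≢0 (ℓ , fˡ⁺¹Ev≡Ev) with invertible⊎degenerate v
      ... | inj₁ v-inv = v-inv
      ... | inj₂ v-deg = contradiction (begin
        E v                          ≡⟨ iter-period f (suc ℓ) fˡ⁺¹Ev≡Ev 2 ⟨
        iter f (2 ℕ.* suc ℓ) (E v)   ≡⟨ iter-f-Degenerate (2 ℕ.* suc ℓ) (ℕ.m≤m*n 2 (suc ℓ)) v∈ v-deg ⟩
        0#                           ∎) Ev≢0

      module _ (s r e : ℕ) (q-1≡sr : q ∸ 1 ≡ s ℕ.* r) (r⊥n : Coprime r n)
               (gᵉ<s : gcd (n ^ℕ e) (q ∸ 1) < s) (e-maximal : ∀ e′ → gcd (n ^ℕ e′) (q ∸ 1) < s → e′ ≤ e) where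

        s∣nᵉ⁺¹ : s ∣ n ^ℕ suc e
        s∣nᵉ⁺¹ = s∣n^E r⊥n (suc e) q-1≡sr {{ℕ.≢-nonZero q∸1≢0}}
                   (ℕ.≮⇒≥ (λ gᵉ⁺¹<s → ℕ.<⇒≱ (ℕ.n<1+n e) (e-maximal (suc e) gᵉ⁺¹<s)))

        Periodic-after-e+1 : ∀ {u} → InFq² u → Invertible u → Periodic T (iter T (suc e) u)
        Periodic-after-e+1 {u} u∈ u-inv =
          Periodic-ψ⇒Periodic (iter-T-Invertible (suc e) u-inv)
            (subst (Periodic h) (sym (iter-ψ (suc e) u)) (j , hʲ⁺¹-fixes))
          where
          r≢0 : r ≢ 0
          r≢0 refl = q∸1≢0 (trans q-1≡sr (ℕ.*-zeroʳ s))
          repunit-multiple : Σ ℕ (λ j → r ∣ repunit n (suc j))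
          repunit-multiple = ∃repunit-multiple r⊥n {{ℕ.≢-nonZero r≢0}}
          j : ℕ
          j = proj₁ repunit-multiple
          q-1∣nᵉ⁺¹R : q ∸ 1 ∣ n ^ℕ suc e ℕ.* repunit n (suc j)
          q-1∣nᵉ⁺¹R = subst (_∣ n ^ℕ suc e ℕ.* repunit n (suc j)) (sym q-1≡sr) (*-pres-∣ s∣nᵉ⁺¹ (proj₂ repunit-multiple))
          hʲ⁺¹-fixes : iter h (suc j) (iter h (suc e) (ψ u)) ≡ iter h (suc e) (ψ u)
          hʲ⁺¹-fixes = trans (sym (iter-+ h (suc j) (suc e) (ψ u)))
                             (iter-h-eventually-periodic (suc e) (suc j) q-1∣nᵉ⁺¹R (^[q∸1]-InFq κ-InFq κ≢0)
                                                         (^[q∸1]-InFq (ψ-InFq u∈) (ψ-Invertible u-inv)))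

        module _ {z : Carrier} (z≢0 : z ≢ 0#) (z-periodic : Periodic f z) where

          u : Carrier × Carrier
          u = coords z

          u∈ : InFq² u
          u∈ = coords-InFq² z

          E-u≡z : E u ≡ z
          E-u≡z = E-coords z

          u-periodic : Periodic T u
          u-periodic = Periodic-f⇒T u∈ (subst (Periodic f) (sym E-u≡z) z-periodic)

          u-Invertible : Invertible u
          u-Invertible = Periodic-nonzero⇒Invertible u∈ (subst (_≢ 0#) (sym E-u≡z) z≢0) (subst (Periodic f) (sym E-u≡z) z-periodic)

          v : Carrier × Carrier
          v = iter T (proj₁ u-periodic ℕ.* suc e) u

          v∈ : InFq² v
          v∈ = iter-T-InFq² (proj₁ u-periodic ℕ.* suc e) u∈

          v-Invertible : Invertible v
          v-Invertible = iter-T-Invertible (proj₁ u-periodic ℕ.* suc e) u-Invertible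

          v-periodic : Periodic T v
          v-periodic = Periodic-iter T (proj₁ u-periodic ℕ.* suc e) u-periodic

          Tᵉ⁺¹v≡u : iter T (suc e) v ≡ u
          Tᵉ⁺¹v≡u = begin
            iter T (suc e) v                  ≡⟨ iter-+ T (suc e) (ℓ ℕ.* suc e) u ⟨
            iter T (suc ℓ ℕ.* suc e) u        ≡⟨ cong (λ i → iter T i u) (ℕ.*-comm (suc ℓ) (suc e)) ⟩
            iter T (suc e ℕ.* suc ℓ) u        ≡⟨ iter-period T (suc ℓ) (proj₂ u-periodic) (suc e) ⟩
            u                                 ∎
            where
            ℓ : ℕ
            ℓ = proj₁ u-periodic

          module _ {η : Carrier} (η∈ : InFq η) (η^nᵉ⁺¹≡1 : η ^ (n ^ℕ suc e) ≡ 1#) (η^nᵉ≢1 : η ^ (n ^ℕ e) ≢ 1#) where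

            w : Carrier × Carrier
            w = scale η v

            w∈ : InFq² w
            w∈ = *-InFq η∈ (proj₁ v∈) , *-InFq η∈ (proj₂ v∈)

            fᵉ⁺¹Ew≡z : iter f (suc e) (E w) ≡ z
            fᵉ⁺¹Ew≡z = begin
              iter f (suc e) (E w)                             ≡⟨ iter-f-E (suc e) w∈ ⟩
              E (iter T (suc e) (scale η v))                   ≡⟨ cong E (iter-T-scale (suc e) η v) ⟩
              E (scale (η ^ (n ^ℕ suc e)) (iter T (suc e) v))  ≡⟨ cong₂ (λ ζ x → E (scale ζ x)) η^nᵉ⁺¹≡1 Tᵉ⁺¹v≡u ⟩
              E (scale 1# u)                                   ≡⟨ cong E (scale-1 u) ⟩
              E u                                              ≡⟨ E-u≡z ⟩
              z                                                ∎

            fⁱEw-aperiodic : ∀ i → i < suc e → ¬ Periodic f (iter f i (E w))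
            fⁱEw-aperiodic i i<1+e fⁱEw-periodic = η^nᵉ≢1 (periodic-twist≡1 Y≢0 ζⁿ≡1 Y-periodic ζY-periodic)
              where
              Tⁱw-periodic : Periodic T (iter T i w)
              Tⁱw-periodic = Periodic-f⇒T (iter-T-InFq² i w∈) (subst (Periodic f) (iter-f-E i w∈) fⁱEw-periodic)
              Tᵉw-periodic : Periodic T (iter T e w)
              Tᵉw-periodic = subst (Periodic T) (trans (sym (iter-+ T (e ∸ i) i w)) (cong (λ t → iter T t w) (ℕ.m∸n+n≡m (ℕ.≤-pred i<1+e))))
                                   (Periodic-iter T (e ∸ i) Tⁱw-periodic)
              ζ : Carrier
              ζ = η ^ (n ^ℕ e)
              ζⁿ≡1 : ζ ^ n ≡ 1#
              ζⁿ≡1 = trans (^-*-assoc η (n ^ℕ e) n) (trans (cong (η ^_) (ℕ.*-comm (n ^ℕ e) n)) η^nᵉ⁺¹≡1)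
              Y : Carrier
              Y = ψ (iter T e v)
              Y≢0 : Y ≢ 0#
              Y≢0 = ψ-Invertible (iter-T-Invertible e v-Invertible)
              Y-periodic : Periodic h Y
              Y-periodic = Periodic-ψ (Periodic-iter T e v-periodic)
              ζY-periodic : Periodic h (ζ * Y)
              ζY-periodic = subst (Periodic h) (trans (cong ψ (iter-T-scale e η v)) (ψ-scale-root _ ζⁿ≡1))
                                  (Periodic-ψ Tᵉw-periodic)

          E-AtLevel-≤ : ∀ {v} l → InFq² v → AtLevel f z (E v) l → l ≤ suc e
          E-AtLevel-≤ {v} l v∈ (fˡEv≡z , below-aperiodic) with l ℕ.≤? suc e | invertible⊎degenerate v
          ... | yes l≤1+e | _         = l≤1+e
          ... | no l≰1+e  | inj₁ v-inv =
            contradiction (subst (Periodic f) (sym (iter-f-E (suc e) v∈)) (Periodic-T⇒f (iter-T-InFq² (suc e) v∈) (Periodic-after-e+1 v∈ v-inv)))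
                          (below-aperiodic (suc e) (ℕ.≰⇒> l≰1+e))
          ... | no l≰1+e  | inj₂ v-deg =
            contradiction (trans (sym fˡEv≡z) (iter-f-Degenerate l (ℕ.≤-trans (s≤s (s≤s z≤n)) (ℕ.≰⇒> l≰1+e)) v∈ v-deg)) z≢0

          AtLevel-≤ : ∀ x l → AtLevel f z x l → l ≤ suc e
          AtLevel-≤ x l x-at-l = E-AtLevel-≤ l (coords-InFq² x) (subst (λ y → AtLevel f z y l) (sym (E-coords x)) x-at-l)

          tree-height : TreeHeight f z (suc e)
          tree-height =
            let η , η∈ , η^nᵉ⁺¹≡1 , η^nᵉ≢1 = ∃η^nᵉ⁺¹≡1∧η^nᵉ≢1 {n} {s} {r} {e} q-1≡sr gᵉ<s s∣nᵉ⁺¹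
            in  (E (w η∈ η^nᵉ⁺¹≡1 η^nᵉ≢1) , fᵉ⁺¹Ew≡z η∈ η^nᵉ⁺¹≡1 η^nᵉ≢1 , fⁱEw-aperiodic η∈ η^nᵉ⁺¹≡1 η^nᵉ≢1)
              , AtLevel-≤

mainTheorem5 :
  (p k q : ℕ) → Prime p → p ≢ 2 → q ≡ p ^ℕ suc k →
  (n : ℕ) → 2 ≤ n → 2 ∣ n →
  (F : FiniteField) → FiniteField.size F ≡ q *ℕ q →
  let open FiniteField F in
  (a c β : Carrier) → a ^ q ≡ a → c ^ q ≡ c →
  β ^ q ≢ β → (β * β) ^ q ≡ β * β →
  let f : Carrier → Carrier
      f x = (c * x ^ q + a * x) * (x ^ q - x) ^ (n ∸ 1)
      m2 : Carrier
      m2 = - (1# + 1#)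
      δ₁ = (a - c) * m2 ^ (n ∸ 1) * β ^ n
      δ₂ = (a + c) * m2 ^ (n ∸ 1) * β ^ (n ∸ 2)
  in δ₁ * δ₂ ≢ 0# →
  (s r e : ℕ) → q ∸ 1 ≡ s *ℕ r → LargestCoprimeDivisor (q ∸ 1) n r →
  gcd (n ^ℕ e) (q ∸ 1) < s → (∀ e′ → gcd (n ^ℕ e′) (q ∸ 1) < s → e′ ≤ e) →
  ∀ z → z ≢ 0# → Periodic f z → TreeHeight f z (suc e)
mainTheorem5 p k q p-prime p≢2 q≡pᵏ⁺¹ .(suc (suc m)) (s≤s (s≤s (z≤n {n = m}))) 2∣n F size≡q² a c β a∈ c∈ β∉ β²∈ δ₁δ₂≢0
             s r e q-1≡sr r-largest gᵉ<s e-maximal z z≢0 z-periodic =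
  tree-height p-prime p≢2 k q q≡pᵏ⁺¹ size≡q² β β∉ β²∈ a c a∈ c∈ m (∣m+n∣m⇒∣n 2∣n ∣-refl) δ₁δ₂≢0
              s r e q-1≡sr (proj₁ (proj₂ r-largest)) gᵉ<s e-maximal z≢0 z-periodic
  where open Dynamics F
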